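{- With $G(x,y,p)$ and the weights $w(C)$ and $|a(C)|$ as in the context, \[ G(x,y,p)=\sum_{n\ge0}y^{n}\sum_{C\in\mathcal C_n}x^{|a(C)|}p^{w(C)}. \]
   Context: **Heaps.** A heap (Viennot) is a finite poset with a labelling by pieces such that concurrent pieces are comparable and covering pieces are concurrent, up to isomorphism. The pieces are monomers $[1,1]$ (only at abscissa $1$) and dimers $[c,c+1]$ with $c\ge1$, concurrent iff they intersect. For a heap $H$ with $N(d)$ dimers and $N(m)$ monomers, set $v(H)=x^{N(d)+N(m)}y^{2N(d)+N(m)}p^{\sum(\text{left abscissae of pieces})}$. Define $G(x,y,p)=\sum_H v(H)$. The sum is over the heaps with a unique maximal piece of left abscissa $1$, plus the empty heap, which contributes $1$. **Symmetric matchings.** $\mathcal C_n$ is the set of symmetric non-crossing perfect matchings on $n$ points. Equivalently, these are words in $\{u,d\}^n$ in which every prefix has at least as many $u$'s as $d$'s. Matched pairs $u\ldots d$ (parenthesis matching) are arches, and unmatched $u$'s are half-arches. $\mathcal C_0$ consists of the empty matching. For $C\in\mathcal C_n$: - $|a(C)|$ is the number of arches plus the number of half-arches; - an arch $a$ joining $i<j$ has weight $w(a)=1+\#\{\text{arches joining } i'<j' \text{ with } i'<i<j<j'\}$; - each half-arch has weight $1$; - $w(C)$ is the sum of the weights of all arches and half-arches. -}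

module Defs where

open import Data.Nat using (ℕ; zero; suc; _+_; _*_; _∸_; _≤_; _<ᵇ_; _≡ᵇ_)
open import Data.Fin using (Fin; zero; suc)
open import Data.Bool using (Bool; true; false; _∧_; not; if_then_else_)
open import Data.List using (List; []; _∷_; map; length; filterᵇ; upTo; take; drop; concatMap)
open import Data.Bool.ListAction using (any)
open import Data.Nat.ListAction using (sum)
open import Data.List.Relation.Unary.All using (All)
open import Data.List.Relation.Unary.Any using (Any)
open import Data.List.Relation.Unary.AllPairs using (AllPairs)
open import Data.List.Relation.Binary.Permutation.Propositional using (_↭_)
open import Data.Product using (Σ; _×_; _,_)
open import Data.Sum using (_⊎_)
open import Relation.Binary.PropositionalEquality using (_≡_; _≢_)
open import Relation.Nullary using (¬_)

-- Pieces
-- mono      = the monomer [1,1]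
-- dimer c   = the dimer [c+1, c+2]   (so every dimer [c',c'+1], c' ≥ 1,
--             occurs exactly once, as dimer (c' - 1))

data Piece : Set where
  mono  : Piece
  dimer : ℕ → Piece

left : Piece → ℕ
left mono      = 1
left (dimer c) = suc c

right : Piece → ℕ
right mono      = 1
right (dimer c) = suc (suc c)

Concurrent : Piece → Piece → Set
Concurrent p q = (left p ≤ right q) × (left q ≤ right p)

isDimer : Piece → ℕ
isDimer mono      = 0
isDimer (dimer _) = 1

isMono : Piece → ℕ
isMono mono      = 1
isMono (dimer _) = 0

sumFin : (k : ℕ) → (Fin k → ℕ) → ℕ
sumFin zero    f = 0
sumFin (suc k) f = f zero + sumFin k (λ i → f (suc i))

Covers : {k : ℕ} → (Fin k → Fin k → Set) → Fin k → Fin k → Set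
Covers {k} _≼_ a b =
  (a ≼ b) × (a ≢ b) × (∀ (c : Fin k) → a ≼ c → c ≼ b → (c ≡ a) ⊎ (c ≡ b))

record Heap : Set₁ where
  field
    size     : ℕ
    lab      : Fin size → Piece
    _≼_      : Fin size → Fin size → Set
    ≼-refl   : ∀ a → a ≼ a
    ≼-antisym : ∀ a b → a ≼ b → b ≼ a → a ≡ b
    ≼-trans  : ∀ a b c → a ≼ b → b ≼ c → a ≼ c
    concurrent⇒comparable : ∀ a b → Concurrent (lab a) (lab b) → (a ≼ b) ⊎ (b ≼ a)
    covering⇒concurrent   : ∀ a b → Covers _≼_ a b → Concurrent (lab a) (lab b)

open Heap public

Iso : Heap → Heap → Set
Iso H H' =
  Σ (Fin (size H) → Fin (size H')) λ σ →
  Σ (Fin (size H') → Fin (size H)) λ τ →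
    (∀ a → τ (σ a) ≡ a) × (∀ b → σ (τ b) ≡ b) ×
    (∀ a b → (_≼_ H a b → _≼_ H' (σ a) (σ b)) × (_≼_ H' (σ a) (σ b) → _≼_ H a b)) ×
    (∀ a → lab H' (σ a) ≡ lab H a)

IsMaximal : (H : Heap) → Fin (size H) → Set
IsMaximal H m = ∀ c → _≼_ H m c → c ≡ m

-- the heaps summed over in G: the empty heap, or a heap with a unique
-- maximal piece, which has left abscissa 1
Admissible : Heap → Set
Admissible H =
  (size H ≡ 0) ⊎
  Σ (Fin (size H)) λ m →
    IsMaximal H m × (∀ m' → IsMaximal H m' → m' ≡ m) × (left (lab H m) ≡ 1)

Ndim Nmono : Heap → ℕ
Ndim  H = sumFin (size H) (λ i → isDimer (lab H i))
Nmono H = sumFin (size H) (λ i → isMono (lab H i))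

-- exponents of v(H) = x^xExp y^yExp p^pExp
xExp yExp pExp : Heap → ℕ
xExp H = Ndim H + Nmono H
yExp H = 2 * Ndim H + Nmono H
pExp H = sumFin (size H) (λ i → left (lab H i))

IsClassList : ℕ → List Heap → Set₁
IsClassList n L =
  All (λ H → Admissible H × (yExp H ≡ n)) L ×
  AllPairs (λ H H' → ¬ Iso H H') L ×
  (∀ H → Admissible H → yExp H ≡ n → Any (Iso H) L)

-- Symmetric non-crossing matchings as words in {u,d}  (true = u, false = d)

allWords : ℕ → List (List Bool)
allWords zero    = [] ∷ []
allWords (suc n) = concatMap (λ w → (true ∷ w) ∷ (false ∷ w) ∷ []) (allWords n)

-- every prefix has at least as many u's as d's (h = current surplus of u's)
prefixOK : ℕ → List Bool → Bool
prefixOK h []            = true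
prefixOK h (true ∷ w)    = prefixOK (suc h) w
prefixOK zero (false ∷ w) = false
prefixOK (suc h) (false ∷ w) = prefixOK h w

balanced : ℕ → List Bool → Bool
balanced h []            = h ≡ᵇ 0
balanced h (true ∷ w)    = balanced (suc h) w
balanced zero (false ∷ w) = false
balanced (suc h) (false ∷ w) = balanced h w

matchings : ℕ → List (List Bool)
matchings n = filterᵇ (prefixOK 0) (allWords n)

nth : List Bool → ℕ → Bool
nth []      _       = false
nth (b ∷ w) zero    = b
nth (b ∷ w) (suc i) = nth w i

matchedᵇ : List Bool → ℕ → ℕ → Bool
matchedᵇ w i j =
  (i <ᵇ j) ∧ (j <ᵇ length w) ∧ nth w i ∧ not (nth w j) ∧
  balanced 0 (take (j ∸ suc i) (drop (suc i) w))

arches : List Bool → List (ℕ × ℕ)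
arches w =
  concatMap (λ i → concatMap (λ j → if matchedᵇ w i j then (i , j) ∷ [] else [])
                             (upTo (length w)))
            (upTo (length w))

halfArches : List Bool → List ℕ
halfArches w =
  filterᵇ (λ i → nth w i ∧ not (any (λ j → matchedᵇ w i j) (upTo (length w))))
          (upTo (length w))

-- the exponent pair (x-exponent , p-exponent) of a monomial
Exps : Set
Exps = ℕ × ℕ

archCount : List Bool → ℕ
archCount w = length (arches w) + length (halfArches w)

encloses : ℕ × ℕ → ℕ × ℕ → Bool
encloses (i' , j') (i , j) = (i' <ᵇ i) ∧ (j <ᵇ j')

archWeight : List Bool → ℕ × ℕ → ℕ
archWeight w a = suc (length (filterᵇ (λ a' → encloses a' a) (arches w)))

weight : List Bool → ℕ
weight w = sum (map (archWeight w) (arches w)) + length (halfArches w)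

-- Read a word over {u, d} from the right: a d followed by p unmatched d's becomes the dimer
-- [p+1, p+2], an unmatched u becomes the monomer, and the word becomes the heap obtained by stacking
-- these pieces.  For a matching, p + 1 is the weight of the arch closed by the d, so the heap of C has
-- exponents |a(C)|, n and w(C); it lies entirely below its last piece, which has abscissa 1.
-- Conversely, every heap is the stack of a list of pieces (remove a minimal piece and recurse), and an
-- admissible stack is, after commuting non-concurrent neighbours, the heap of a matching: by induction
-- on the list, a monomer at the bottom is a leading u, and a dimer [k+1, k+2] at the bottom slides up
-- to the first suffix with k unmatched d's, where it becomes a new arch ud; without such a suffix the
-- dimer would be a second maximal piece.  Finally the heap determines the word letter by letter: a
-- wrong first letter would put a minimal piece over the dimers of the unmatched d's.

module Submission where

open import Defs

open import Data.Bool using (Bool; true; false; T; _∧_; not; if_then_else_)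
import Data.Bool.Properties as Bool
open import Data.Bool.ListAction using (any; or)
open import Data.Empty using (⊥; ⊥-elim)
open import Data.Fin using (Fin; zero; suc; fromℕ; toℕ; punchIn; punchOut)
open import Data.Fin.Induction using (po-wellFounded; po-noetherian)
open import Data.Fin.Permutation
  using (Permutation; _⟨$⟩ʳ_; _⟨$⟩ˡ_; inverseˡ; inverseʳ; permutation; lift₀; remove; lift₀-remove; transpose;
         insert; insert-punchIn; ↔⇒≡)
open import Data.Fin.Properties
  using (_≟_; any?; all?; suc-injective; ≤fromℕ; punchIn-injective; punchInᵢ≢i; punchIn-punchOut)
import Data.Fin.Properties as Fin
open import Data.List using (List; []; _∷_; _++_; length; lookup; map; drop; take; concatMap; filterᵇ; upTo)
open import Data.List.Membership.Propositional using (_∈_)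
open import Data.List.Membership.Propositional.Properties using (∈-filter⁺; ∈-filter⁻)
open import Data.List.Properties
  using (∷-injectiveʳ; map-upTo; concatMap-map; concatMap-cong; map-++; map-∘; map-cong; map-cong-local;
         length-map; length-++; filter-accept; filter-++)
open import Data.List.Relation.Binary.Permutation.Propositional using (_↭_; ↭-reflexive)
open import Data.List.Relation.Unary.All using (All; []; _∷_)
import Data.List.Relation.Unary.All as All
import Data.List.Relation.Unary.All.Properties as All
open import Data.List.Relation.Unary.AllPairs using (AllPairs; []; _∷_)
import Data.List.Relation.Unary.AllPairs as AllPairs
import Data.List.Relation.Unary.AllPairs.Properties as AllPairs
open import Data.List.Relation.Unary.Any using (Any; here; there)
import Data.List.Relation.Unary.Any as Any
import Data.List.Relation.Unary.Any.Properties as Any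
open import Data.Nat using (ℕ; zero; suc; pred; _+_; _*_; _≤_; _<_; _≤?_; _<ᵇ_; _≡ᵇ_; z≤n; s≤s)
open import Data.Nat.ListAction using () renaming (sum to sumₗ)
import Data.Nat.Properties as ℕ
open import Data.Nat.Tactic.RingSolver using (solve-∀)
open import Data.Product using (Σ; ∃-syntax; _×_; _,_; proj₁; proj₂)
open import Data.Sum using (_⊎_; inj₁; inj₂)
import Data.Sum as Sum
open import Data.Unit using (⊤; tt)
open import Function using (_∘_; id)
open import Induction.WellFounded using (Acc; acc)
open import Relation.Binary.Definitions using (Decidable)
open import Relation.Binary.PropositionalEquality
  using (_≡_; _≢_; refl; sym; trans; cong; cong₂; subst; subst₂; isEquivalence; module ≡-Reasoning)
open import Relation.Binary.Structures using (IsPartialOrder)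
open import Relation.Nullary using (¬_; Dec; yes; no; _×-dec_; _→-dec_; ¬?; T?)
open import Relation.Nullary.Decidable using (decidable-stable; ¬¬-excluded-middle)

open import Algebra.Properties.CommutativeMonoid.Sum ℕ.+-0-commutativeMonoid using (sum; sum-permute; sum-cong-≗)
open import Algebra.Properties.CommutativeSemigroup ℕ.+-commutativeSemigroup
  using () renaming (x∙yz≈y∙xz to +-left-comm)

n≤1+pred[n] : ∀ n → n ≤ suc (pred n)
n≤1+pred[n] zero    = z≤n
n≤1+pred[n] (suc n) = ℕ.≤-refl

¬¬-Π : ∀ {n} {P : Fin n → Set} → (∀ i → ¬ ¬ P i) → ¬ ¬ (∀ i → P i)
¬¬-Π {zero}  _      ¬∀ = ¬∀ λ ()
¬¬-Π {suc n} ¬¬P ¬∀ = ¬¬P zero λ P0 → ¬¬-Π (¬¬P ∘ suc) λ P-suc → ¬∀ λ { zero → P0 ; (suc i) → P-suc i }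

insert-at-i : ∀ {m n} (i : Fin (suc m)) (j : Fin (suc n)) (π : Permutation m n) → insert i j π ⟨$⟩ʳ i ≡ j
insert-at-i i j π with i ≟ i
... | yes _   = refl
... | no i≢i = ⊥-elim (i≢i refl)

upTo-suc : ∀ n → upTo (suc n) ≡ 0 ∷ map suc (upTo n)
upTo-suc n = cong (0 ∷_) (sym (map-upTo suc n))

module _ {A : Set} where

  concatMap-upTo-suc : ∀ (f : ℕ → List A) n → concatMap f (upTo (suc n)) ≡ f 0 ++ concatMap (f ∘ suc) (upTo n)
  concatMap-upTo-suc f n = trans (cong (concatMap f) (upTo-suc n)) (cong (f 0 ++_) (concatMap-map f suc (upTo n)))

  concatMap-[] : ∀ {B : Set} (f : B → List A) xs → (∀ x → f x ≡ []) → concatMap f xs ≡ []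
  concatMap-[] f []       _     = refl
  concatMap-[] f (x ∷ xs) f≡[] = trans (cong (_++ concatMap f xs) (f≡[] x)) (concatMap-[] f xs f≡[])

  concatMap-pick : ∀ q (g : ℕ → A) m → q < m → concatMap (λ j → if q ≡ᵇ j then g j ∷ [] else []) (upTo m) ≡ g q ∷ []
  concatMap-pick zero    g (suc m) _ =
    trans (concatMap-upTo-suc (λ j → if 0 ≡ᵇ j then g j ∷ [] else []) m)
          (cong (g 0 ∷_) (concatMap-[] _ (upTo m) λ _ → refl))
  concatMap-pick (suc q) g (suc m) (s≤s q<m) =
    trans (concatMap-upTo-suc (λ j → if suc q ≡ᵇ j then g j ∷ [] else []) m) (concatMap-pick q (g ∘ suc) m q<m)

  any-map : ∀ {B : Set} (p : A → Bool) (f : B → A) xs → any p (map f xs) ≡ any (p ∘ f) xs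
  any-map p f xs = cong or (sym (map-∘ xs))

  any-false : ∀ xs → any (λ (_ : A) → false) xs ≡ false
  any-false []       = refl
  any-false (x ∷ xs) = any-false xs

  concatMap-map-out : ∀ {B C : Set} (g : B → C) (f : A → List B) xs →
                      concatMap (map g ∘ f) xs ≡ map g (concatMap f xs)
  concatMap-map-out g f []       = refl
  concatMap-map-out g f (x ∷ xs) = trans (cong (map g (f x) ++_) (concatMap-map-out g f xs)) (sym (map-++ g (f x) _))

  any-cong : ∀ {p q : A → Bool} → (∀ x → p x ≡ q x) → ∀ xs → any p xs ≡ any q xs
  any-cong p≗q xs = cong or (map-cong p≗q xs)

  filterᵇ-∷ : ∀ (p : A → Bool) x xs → filterᵇ p (x ∷ xs) ≡ (if p x then x ∷ filterᵇ p xs else filterᵇ p xs)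
  filterᵇ-∷ p x xs with p x
  ... | true  = refl
  ... | false = refl

  filterᵇ-map : ∀ {B : Set} (p : A → Bool) (f : B → A) xs → filterᵇ p (map f xs) ≡ map f (filterᵇ (p ∘ f) xs)
  filterᵇ-map p f []       = refl
  filterᵇ-map p f (x ∷ xs) with p (f x)
  ... | true  = cong (f x ∷_) (filterᵇ-map p f xs)
  ... | false = filterᵇ-map p f xs

  filterᵇ-cong : ∀ {p q : A → Bool} → (∀ x → p x ≡ q x) → ∀ xs → filterᵇ p xs ≡ filterᵇ q xs
  filterᵇ-cong {p} {q} p≗q []       = refl
  filterᵇ-cong {p} {q} p≗q (x ∷ xs) rewrite p≗q x with q x
  ... | true  = cong (x ∷_) (filterᵇ-cong p≗q xs)
  ... | false = filterᵇ-cong p≗q xs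

  filterᵇ-false : ∀ xs → filterᵇ (λ (_ : A) → false) xs ≡ []
  filterᵇ-false []       = refl
  filterᵇ-false (x ∷ xs) = filterᵇ-false xs

  length-filterᵇ-singleton : ∀ (p : A → Bool) x → length (filterᵇ p (x ∷ [])) ≡ (if p x then 1 else 0)
  length-filterᵇ-singleton p x with p x
  ... | true  = refl
  ... | false = refl

  sum-suc : ∀ (f : A → ℕ) xs → sumₗ (map (suc ∘ f) xs) ≡ length xs + sumₗ (map f xs)
  sum-suc f []       = refl
  sum-suc f (x ∷ xs) = cong suc (trans (cong (f x +_) (sum-suc f xs)) (+-left-comm (f x) (length xs) _))

  sum-indicator : ∀ (p : A → Bool) (f : A → ℕ) xs →
                  sumₗ (map (λ x → (if p x then 1 else 0) + f x) xs) ≡ length (filterᵇ p xs) + sumₗ (map f xs)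
  sum-indicator p f []       = refl
  sum-indicator p f (x ∷ xs) with p x
  ... | true  = cong suc (trans (cong (f x +_) (sum-indicator p f xs)) (+-left-comm (f x) (length (filterᵇ p xs)) _))
  ... | false = trans (cong (f x +_) (sum-indicator p f xs)) (+-left-comm (f x) (length (filterᵇ p xs)) _)

any-pick : ∀ q m → q < m → any (q ≡ᵇ_) (upTo m) ≡ true
any-pick zero    (suc m) _          = refl
any-pick (suc q) (suc m) (s≤s q<m) =
  trans (cong (any (suc q ≡ᵇ_)) (upTo-suc m)) (trans (any-map _ suc (upTo m)) (any-pick q m q<m))

AllPairs-map-local : ∀ {A : Set} {P : A → Set} {R S : A → A → Set} → (∀ {x y} → P x → P y → R x y → S x y) →
                      ∀ {xs} → All P xs → AllPairs R xs → AllPairs S xs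
AllPairs-map-local f []         []         = []
AllPairs-map-local f (px ∷ pxs) (rxs ∷ rs) =
  All.zipWith (λ (py , rxy) → f px py rxy) (pxs , rxs) ∷ AllPairs-map-local f pxs rs

-- Heaps of lists of pieces

concurrent? : Decidable Concurrent
concurrent? p q = (left p ≤? right q) ×-dec (left q ≤? right p)

concurrent-sym : ∀ {p q} → Concurrent p q → Concurrent q p
concurrent-sym (p≤q , q≤p) = q≤p , p≤q

concurrent-refl : ∀ p → Concurrent p p
concurrent-refl mono      = ℕ.≤-refl , ℕ.≤-refl
concurrent-refl (dimer c) = ℕ.n≤1+n _ , ℕ.n≤1+n _

1≤right : ∀ p → 1 ≤ right p
1≤right mono      = s≤s z≤n
1≤right (dimer _) = s≤s z≤n

left≡1⇒concurrent : ∀ {p q} → left p ≡ 1 → left q ≡ 1 → Concurrent p q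
left≡1⇒concurrent {p} {q} lp≡1 lq≡1 =
  subst (_≤ right q) (sym lp≡1) (1≤right q) , subst (_≤ right p) (sym lq≡1) (1≤right p)

right<left⇒¬concurrent : ∀ p q → right q < left p → ¬ Concurrent p q
right<left⇒¬concurrent p q q<p (p≤q , _) = ℕ.<⇒≱ q<p p≤q

dimer-injective : ∀ {m n} → dimer m ≡ dimer n → m ≡ n
dimer-injective refl = refl

dimer-suc-concurrent : ∀ j → Concurrent (dimer (suc j)) (dimer j)
dimer-suc-concurrent j = ℕ.≤-refl , ℕ.m≤n⇒m≤1+n (ℕ.n≤1+n _)

-- The heap obtained by stacking the pieces of w from the bottom (the head) upwards:
-- i lies below j iff a chain of successively concurrent pieces climbs from i to j.
Below : (w : List Piece) → Fin (length w) → Fin (length w) → Set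
Below (a ∷ w) zero    zero    = ⊤
Below (a ∷ w) zero    (suc j) = ∃[ i ] Concurrent a (lookup w i) × Below w i j
Below (a ∷ w) (suc i) zero    = ⊥
Below (a ∷ w) (suc i) (suc j) = Below w i j

Below-refl : ∀ w i → Below w i i
Below-refl (a ∷ w) zero    = tt
Below-refl (a ∷ w) (suc i) = Below-refl w i

Below-antisym : ∀ w i j → Below w i j → Below w j i → i ≡ j
Below-antisym (a ∷ w) zero    zero    _ _ = refl
Below-antisym (a ∷ w) (suc i) (suc j) p q = cong suc (Below-antisym w i j p q)

Below-trans : ∀ w i j k → Below w i j → Below w j k → Below w i k
Below-trans (a ∷ w) zero    zero    k       _           q = q
Below-trans (a ∷ w) zero    (suc j) (suc k) (i , c , p) q = i , c , Below-trans w i j k p q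
Below-trans (a ∷ w) (suc i) (suc j) (suc k) p           q = Below-trans w i j k p q

Below-comparable : ∀ w i j → Concurrent (lookup w i) (lookup w j) → Below w i j ⊎ Below w j i
Below-comparable (a ∷ w) zero    zero    _ = inj₁ tt
Below-comparable (a ∷ w) zero    (suc j) c = inj₁ (j , c , Below-refl w j)
Below-comparable (a ∷ w) (suc i) zero    c = inj₂ (i , concurrent-sym c , Below-refl w i)
Below-comparable (a ∷ w) (suc i) (suc j) c = Below-comparable w i j c

Below-covering⇒concurrent : ∀ w i j → Covers (Below w) i j → Concurrent (lookup w i) (lookup w j)
Below-covering⇒concurrent (a ∷ w) zero zero (_ , i≢j , _) = ⊥-elim (i≢j refl)
Below-covering⇒concurrent (a ∷ w) zero (suc j) ((i , c , i≤j) , _ , between)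
  with between (suc i) (i , c , Below-refl w i) i≤j
... | inj₂ i≡j = subst (Concurrent a ∘ lookup w) (suc-injective i≡j) c
Below-covering⇒concurrent (a ∷ w) (suc i) (suc j) (i≤j , i≢j , between) =
  Below-covering⇒concurrent w i j
    (i≤j , i≢j ∘ cong suc , λ c i≤c c≤j → Sum.map suc-injective suc-injective (between (suc c) i≤c c≤j))

below? : ∀ w → Decidable (Below w)
below? (a ∷ w) zero    zero    = yes tt
below? (a ∷ w) zero    (suc j) = any? λ i → concurrent? a (lookup w i) ×-dec below? w i j
below? (a ∷ w) (suc i) zero    = no λ ()
below? (a ∷ w) (suc i) (suc j) = below? w i j

Below-monotone : ∀ w i j → Below w i j → toℕ i ≤ toℕ j
Below-monotone (a ∷ w) zero    j       _ = z≤n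
Below-monotone (a ∷ w) (suc i) (suc j) p = s≤s (Below-monotone w i j p)

heapOf : List Piece → Heap
heapOf w = record
  { size                  = length w
  ; lab                   = lookup w
  ; _≼_                   = Below w
  ; ≼-refl                = Below-refl w
  ; ≼-antisym             = Below-antisym w
  ; ≼-trans               = Below-trans w
  ; concurrent⇒comparable = Below-comparable w
  ; covering⇒concurrent   = Below-covering⇒concurrent w
  }

Iso-refl : ∀ {H} → Iso H H
Iso-refl = id , id , (λ _ → refl) , (λ _ → refl) , (λ _ _ → id , id) , λ _ → refl

Iso-sym : ∀ {H H′} → Iso H H′ → Iso H′ H
Iso-sym {H} {H′} (σ , τ , τσ , στ , order , label) =
  τ , σ , στ , τσ ,
  (λ a b → (λ a≼b → proj₂ (order (τ a) (τ b)) (subst₂ (_≼_ H′) (sym (στ a)) (sym (στ b)) a≼b)) ,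
           (λ τa≼τb → subst₂ (_≼_ H′) (στ a) (στ b) (proj₁ (order (τ a) (τ b)) τa≼τb))) ,
  λ a → trans (sym (label (τ a))) (cong (lab H′) (στ a))

Iso-trans : ∀ {H H′ H′′} → Iso H H′ → Iso H′ H′′ → Iso H H′′
Iso-trans (σ , τ , τσ , στ , order , label) (σ′ , τ′ , τσ′ , στ′ , order′ , label′) =
  σ′ ∘ σ , τ ∘ τ′ ,
  (λ a → trans (cong τ (τσ′ (σ a))) (τσ a)) ,
  (λ c → trans (cong σ′ (στ (τ′ c))) (στ′ c)) ,
  (λ a b → proj₁ (order′ (σ a) (σ b)) ∘ proj₁ (order a b) ,
           proj₂ (order a b) ∘ proj₂ (order′ (σ a) (σ b))) ,
  λ a → trans (label′ (σ a)) (label a)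

Iso⇒Permutation : ∀ {H H′} → Iso H H′ → Permutation (size H) (size H′)
Iso⇒Permutation (σ , τ , τσ , στ , _) = permutation σ τ στ τσ

isoVia : ∀ {H H′} (π : Permutation (size H) (size H′)) →
         (∀ a b → (_≼_ H a b → _≼_ H′ (π ⟨$⟩ʳ a) (π ⟨$⟩ʳ b)) × (_≼_ H′ (π ⟨$⟩ʳ a) (π ⟨$⟩ʳ b) → _≼_ H a b)) →
         (∀ a → lab H′ (π ⟨$⟩ʳ a) ≡ lab H a) → Iso H H′
isoVia π order label = (π ⟨$⟩ʳ_) , (π ⟨$⟩ˡ_) , (λ _ → inverseˡ π) , (λ _ → inverseʳ π) , order , label

sumFin≡sum : ∀ k (f : Fin k → ℕ) → sumFin k f ≡ sum f
sumFin≡sum zero    f = refl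
sumFin≡sum (suc k) f = cong (f zero +_) (sumFin≡sum k (f ∘ suc))

sumFin-Iso : ∀ {H H′} → Iso H H′ → (f : Piece → ℕ) →
             sumFin (size H) (f ∘ lab H) ≡ sumFin (size H′) (f ∘ lab H′)
sumFin-Iso {H} {H′} I@(σ , _ , _ , _ , _ , label) f = begin
  sumFin (size H) (f ∘ lab H)         ≡⟨ sumFin≡sum (size H) _ ⟩
  sum (f ∘ lab H)                     ≡⟨ sum-cong-≗ (λ a → cong f (sym (label a))) ⟩
  sum (f ∘ lab H′ ∘ σ)                ≡⟨ sum-permute (f ∘ lab H′) (Iso⇒Permutation {H} {H′} I) ⟨
  sum (f ∘ lab H′)                    ≡⟨ sumFin≡sum (size H′) _ ⟨
  sumFin (size H′) (f ∘ lab H′)       ∎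
  where open ≡-Reasoning

yExp-Iso : ∀ {H H′} → Iso H H′ → yExp H ≡ yExp H′
yExp-Iso {H} {H′} I = cong₂ (λ d m → 2 * d + m) (sumFin-Iso {H} {H′} I isDimer) (sumFin-Iso {H} {H′} I isMono)

IsMinimal : (H : Heap) → Fin (size H) → Set
IsMinimal H m = ∀ c → _≼_ H c m → c ≡ m

-- Pieces with equal labels are concurrent, hence comparable.
minimal-unique : ∀ H {x y} → IsMinimal H x → IsMinimal H y → lab H x ≡ lab H y → x ≡ y
minimal-unique H {x} {y} x-min y-min lx≡ly
  with concurrent⇒comparable H x y (subst (Concurrent (lab H x)) lx≡ly (concurrent-refl (lab H x)))
... | inj₁ x≼y = y-min x x≼y
... | inj₂ y≼x = sym (x-min y y≼x)

IsMinimal-Iso : ∀ {H H′} (I : Iso H H′) {x} → IsMinimal H x → IsMinimal H′ (proj₁ I x)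
IsMinimal-Iso {H′ = H′} (σ , τ , _ , στ , order , _) {x} x-min c c≼σx =
  trans (sym (στ c)) (cong σ (x-min (τ c) (proj₂ (order (τ c) x) (subst (λ z → _≼_ H′ z (σ x)) (sym (στ c)) c≼σx))))

IsMaximal-Iso : ∀ {H H′} (I : Iso H H′) {x} → IsMaximal H x → IsMaximal H′ (proj₁ I x)
IsMaximal-Iso {H′ = H′} (σ , τ , _ , στ , order , _) {x} x-max c σx≼c =
  trans (sym (στ c)) (cong σ (x-max (τ c) (proj₂ (order x (τ c)) (subst (_≼_ H′ (σ x)) (sym (στ c)) σx≼c))))

Admissible-Iso : ∀ {H H′} → Iso H H′ → Admissible H → Admissible H′
Admissible-Iso {H} {H′} I (inj₁ empty) = inj₁ (trans (sym (↔⇒≡ (Iso⇒Permutation {H} {H′} I))) empty)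
Admissible-Iso {H} {H′} I@(σ , τ , τσ , στ , _ , label) (inj₂ (m , m-max , m-unique , m-left)) =
  inj₂ (σ m , IsMaximal-Iso {H} {H′} I m-max ,
        (λ m′ m′-max → trans (sym (στ m′))
                             (cong σ (m-unique (τ m′) (IsMaximal-Iso {H′} {H} (Iso-sym {H} {H′} I) m′-max)))) ,
        trans (cong left (label m)) m-left)

bottom-minimal : ∀ a w → IsMinimal (heapOf (a ∷ w)) zero
bottom-minimal a w zero _ = refl

top-maximal : ∀ a w → IsMaximal (heapOf (a ∷ w)) (fromℕ (length w))
top-maximal a w c top≼c = Fin.≤-antisym (≤fromℕ c) (Below-monotone (a ∷ w) _ c top≼c)

Admissible-tail : ∀ a w → Admissible (heapOf (a ∷ w)) → Admissible (heapOf w)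
Admissible-tail a []      _ = inj₁ refl
Admissible-tail a (b ∷ w) (inj₂ (zero , _ , unique , _)) with unique _ (top-maximal a (b ∷ w))
... | ()
Admissible-tail a (b ∷ w) (inj₂ (suc m , m-max , unique , m-left)) =
  inj₂ (m , (λ c m≼c → suc-injective (m-max (suc c) m≼c)) ,
        (λ m′ m′-max → suc-injective (unique (suc m′) (raise m′-max))) , m-left)
  where
  raise : ∀ {m′} → IsMaximal (heapOf (b ∷ w)) m′ → IsMaximal (heapOf (a ∷ b ∷ w)) (suc m′)
  raise m′-max (suc c) m′≼c = cong suc (m′-max c m′≼c)

Iso-∷ : ∀ a {w w′} → Iso (heapOf w) (heapOf w′) → Iso (heapOf (a ∷ w)) (heapOf (a ∷ w′))
Iso-∷ a {w} {w′} I@(σ , τ , _ , στ , order , label) =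
  isoVia {heapOf (a ∷ w)} {heapOf (a ∷ w′)} π order′ label′
  where
  π = lift₀ (Iso⇒Permutation {heapOf w} {heapOf w′} I)
  order′ : ∀ x y → (Below (a ∷ w) x y → Below (a ∷ w′) (π ⟨$⟩ʳ x) (π ⟨$⟩ʳ y)) ×
                   (Below (a ∷ w′) (π ⟨$⟩ʳ x) (π ⟨$⟩ʳ y) → Below (a ∷ w) x y)
  order′ zero    zero    = id , id
  order′ zero    (suc j) =
    (λ { (i , c , i≤j) → σ i , subst (Concurrent a) (sym (label i)) c , proj₁ (order i j) i≤j }) ,
    (λ { (i , c , i≤σj) → τ i ,
                          subst (Concurrent a) (trans (cong (lookup w′) (sym (στ i))) (label (τ i))) c ,
                          proj₂ (order (τ i) j) (subst (λ z → Below w′ z (σ j)) (sym (στ i)) i≤σj) })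
  order′ (suc i) zero    = (λ ()) , (λ ())
  order′ (suc i) (suc j) = order i j
  label′ : ∀ x → lookup (a ∷ w′) (π ⟨$⟩ʳ x) ≡ lookup (a ∷ w) x
  label′ zero    = refl
  label′ (suc i) = label i

Below-skip : ∀ {a b w j} → ¬ Concurrent a b → Below (a ∷ b ∷ w) zero (suc (suc j)) → Below (a ∷ w) zero (suc j)
Below-skip a≁b (zero  , a~b , _) = ⊥-elim (a≁b a~b)
Below-skip a≁b (suc i , c   , p) = i , c , p

Below-unskip : ∀ {a b w j} → Below (a ∷ w) zero (suc j) → Below (a ∷ b ∷ w) zero (suc (suc j))
Below-unskip (i , c , p) = suc i , c , p

Below-nonconcurrent : ∀ {a b w} → ¬ Concurrent a b → ¬ Below (a ∷ b ∷ w) zero (suc zero)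
Below-nonconcurrent a≁b (zero , a~b , _) = a≁b a~b

Iso-swap : ∀ {a b} w → ¬ Concurrent a b → Iso (heapOf (a ∷ b ∷ w)) (heapOf (b ∷ a ∷ w))
Iso-swap {a} {b} w a≁b = isoVia {heapOf (a ∷ b ∷ w)} {heapOf (b ∷ a ∷ w)} π order label
  where
  π = transpose zero (suc zero)
  b≁a = a≁b ∘ concurrent-sym
  order : ∀ x y → (Below (a ∷ b ∷ w) x y → Below (b ∷ a ∷ w) (π ⟨$⟩ʳ x) (π ⟨$⟩ʳ y)) ×
                  (Below (b ∷ a ∷ w) (π ⟨$⟩ʳ x) (π ⟨$⟩ʳ y) → Below (a ∷ b ∷ w) x y)
  order zero                zero                = id , id
  order zero                (suc zero)          = ⊥-elim ∘ Below-nonconcurrent a≁b , (λ ())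
  order zero                (suc (suc j))       = Below-skip a≁b , Below-unskip
  order (suc zero)          zero                = (λ ()) , ⊥-elim ∘ Below-nonconcurrent b≁a
  order (suc zero)          (suc zero)          = id , id
  order (suc zero)          (suc (suc j))       = Below-unskip , Below-skip b≁a
  order (suc (suc i))       zero                = (λ ()) , (λ ())
  order (suc (suc i))       (suc zero)          = (λ ()) , (λ ())
  order (suc (suc i))       (suc (suc j))       = id , id
  label : ∀ x → lookup (b ∷ a ∷ w) (π ⟨$⟩ʳ x) ≡ lookup (a ∷ b ∷ w) x
  label zero          = refl
  label (suc zero)    = refl
  label (suc (suc i)) = refl

Iso-∷⁻¹ : ∀ a {w w′} → Iso (heapOf (a ∷ w)) (heapOf (a ∷ w′)) → Iso (heapOf w) (heapOf w′)
Iso-∷⁻¹ a {w} {w′} I@(σ , _ , _ , _ , order , label) = isoVia {heapOf w} {heapOf w′} π′ order′ label′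
  where
  π = Iso⇒Permutation {heapOf (a ∷ w)} {heapOf (a ∷ w′)} I
  π′ = remove zero π
  σ0≡0 : σ zero ≡ zero
  σ0≡0 = minimal-unique (heapOf (a ∷ w′))
           (IsMinimal-Iso {heapOf (a ∷ w)} {heapOf (a ∷ w′)} I (bottom-minimal a w))
           (bottom-minimal a w′) (label zero)
  σ-suc : ∀ i → σ (suc i) ≡ suc (π′ ⟨$⟩ʳ i)
  σ-suc i = sym (lift₀-remove π σ0≡0 (suc i))
  order′ : ∀ i j → (Below w i j → Below w′ (π′ ⟨$⟩ʳ i) (π′ ⟨$⟩ʳ j)) × (Below w′ (π′ ⟨$⟩ʳ i) (π′ ⟨$⟩ʳ j) → Below w i j)
  order′ i j = subst₂ (Below (a ∷ w′)) (σ-suc i) (σ-suc j) ∘ proj₁ (order (suc i) (suc j)) ,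
               proj₂ (order (suc i) (suc j)) ∘ subst₂ (Below (a ∷ w′)) (sym (σ-suc i)) (sym (σ-suc j))
  label′ : ∀ i → lookup w′ (π′ ⟨$⟩ʳ i) ≡ lookup w i
  label′ i = trans (cong (lookup (a ∷ w′)) (sym (σ-suc i))) (label (suc i))

-- Every heap is the heap of a list of pieces

module FiniteDecPoset {k} {_⊑_ : Fin k → Fin k → Set}
                      (isPO : IsPartialOrder _≡_ _⊑_) (_⊑?_ : Decidable _⊑_) where

  open IsPartialOrder isPO using () renaming (refl to ⊑-refl; trans to ⊑-trans)

  _⊏_ : Fin k → Fin k → Set
  x ⊏ y = x ⊑ y × x ≢ y

  between? : ∀ y x → Dec (∃[ c ] y ⊏ c × c ⊏ x)
  between? y x = any? λ c → ((y ⊑? c) ×-dec ¬? (y ≟ c)) ×-dec ((c ⊑? x) ×-dec ¬? (c ≟ x))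

  covers-unless-between : ∀ {y x} → y ⊏ x → ¬ (∃[ c ] y ⊏ c × c ⊏ x) → Covers _⊑_ y x
  covers-unless-between {y} {x} (y⊑x , y≢x) nothing = y⊑x , y≢x , onEnds
    where
    onEnds : ∀ c → y ⊑ c → c ⊑ x → c ≡ y ⊎ c ≡ x
    onEnds c y⊑c c⊑x with c ≟ y | c ≟ x
    ... | yes c≡y | _       = inj₁ c≡y
    ... | no _    | yes c≡x = inj₂ c≡x
    ... | no c≢y  | no c≢x  = ⊥-elim (nothing (c , (y⊑c , c≢y ∘ sym) , (c⊑x , c≢x)))

  cover-above : ∀ {y x} → y ⊏ x → ∃[ z ] Covers _⊑_ y z × z ⊑ x
  cover-above {y} {x} = go (po-wellFounded isPO x)
    where
    go : ∀ {x} → Acc _⊏_ x → y ⊏ x → ∃[ z ] Covers _⊑_ y z × z ⊑ x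
    go {x} (acc below) y⊏x with between? y x
    ... | no nothing = x , covers-unless-between y⊏x nothing , ⊑-refl
    ... | yes (c , y⊏c , c⊏x) with go (below c⊏x) y⊏c
    ...   | z , y⋖z , z⊑c = z , y⋖z , ⊑-trans z⊑c (proj₁ c⊏x)

  cover-below : ∀ {y x} → y ⊏ x → ∃[ z ] y ⊑ z × Covers _⊑_ z x
  cover-below {y} {x} = go (po-noetherian isPO y)
    where
    go : ∀ {y} → Acc (λ a b → b ⊏ a) y → y ⊏ x → ∃[ z ] y ⊑ z × Covers _⊑_ z x
    go {y} (acc above) y⊏x with between? y x
    ... | no nothing = y , ⊑-refl , covers-unless-between y⊏x nothing
    ... | yes (c , y⊏c , c⊏x) with go (above y⊏c) c⊏x
    ...   | z , c⊑z , z⋖x = z , ⊑-trans (proj₁ y⊏c) c⊑z , z⋖x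

  minimal-below : ∀ x → ∃[ z ] z ⊑ x × (∀ c → c ⊑ z → c ≡ z)
  minimal-below x = go (po-wellFounded isPO x)
    where
    go : ∀ {x} → Acc _⊏_ x → ∃[ z ] z ⊑ x × (∀ c → c ⊑ z → c ≡ z)
    go {x} (acc below) with any? (λ c → (c ⊑? x) ×-dec ¬? (c ≟ x))
    ... | yes (c , c⊏x) with go (below c⊏x)
    ...   | z , z⊑c , z-min = z , ⊑-trans z⊑c (proj₁ c⊏x) , z-min
    go {x} (acc below) | no none =
      x , ⊑-refl , λ c c⊑x → decidable-stable (c ≟ x) λ c≢x → none (c , c⊑x , c≢x)

-- A heap indexed by its size, so that removing a piece is a map from size suc k to size k.
record HeapOn (k : ℕ) : Set₁ where
  field
    label      : Fin k → Piece
    _⊑_        : Fin k → Fin k → Set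
    ⊑-refl     : ∀ a → a ⊑ a
    ⊑-antisym  : ∀ a b → a ⊑ b → b ⊑ a → a ≡ b
    ⊑-trans    : ∀ a b c → a ⊑ b → b ⊑ c → a ⊑ c
    comparable : ∀ a b → Concurrent (label a) (label b) → a ⊑ b ⊎ b ⊑ a
    covering   : ∀ a b → Covers _⊑_ a b → Concurrent (label a) (label b)

  ⊑-isPartialOrder : IsPartialOrder _≡_ _⊑_
  ⊑-isPartialOrder = record
    { isPreorder = record
      { isEquivalence = isEquivalence
      ; reflexive     = λ { refl → ⊑-refl _ }
      ; trans         = λ {a b c} → ⊑-trans a b c
      }
    ; antisym = λ {a b} → ⊑-antisym a b
    }

toHeap : ∀ {k} → HeapOn k → Heap
toHeap {k} X = record
  { size = k ; lab = label ; _≼_ = _⊑_ ; ≼-refl = ⊑-refl ; ≼-antisym = ⊑-antisym ; ≼-trans = ⊑-trans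
  ; concurrent⇒comparable = comparable ; covering⇒concurrent = covering }
  where open HeapOn X

fromHeap : (H : Heap) → HeapOn (size H)
fromHeap H = record
  { label = lab H ; _⊑_ = _≼_ H ; ⊑-refl = ≼-refl H ; ⊑-antisym = ≼-antisym H ; ⊑-trans = ≼-trans H
  ; comparable = concurrent⇒comparable H ; covering = covering⇒concurrent H }

module Peel {k} (X : HeapOn (suc k)) where
  open HeapOn X

  -- The order of a finite heap need not be decidable constructively, but it is not undecidable;
  -- this suffices for establishing the decidable statements below.
  ¬¬-decidable : ¬ ¬ Decidable _⊑_
  ¬¬-decidable = ¬¬-Π λ a → ¬¬-Π λ b → ¬¬-excluded-middle

  module Decided (⊑-dec : Decidable _⊑_) = FiniteDecPoset ⊑-isPartialOrder ⊑-dec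

  -- Unlike ⊑ itself, ⊑ between concurrent pieces is decidable.
  Supports : Fin (suc k) → Fin (suc k) → Set
  Supports a b = Concurrent (label a) (label b) × a ⊑ b

  supports? : Decidable Supports
  supports? a b with concurrent? (label a) (label b)
  ... | no a≁b = no (a≁b ∘ proj₁)
  ... | yes a~b with comparable a b a~b | a ≟ b
  ...   | inj₁ a⊑b | _       = yes (a~b , a⊑b)
  ...   | inj₂ _   | yes refl = yes (a~b , ⊑-refl a)
  ...   | inj₂ b⊑a | no a≢b  = no λ s → a≢b (⊑-antisym a b (proj₂ s) b⊑a)

  IsSource : Fin (suc k) → Set
  IsSource x = ∀ y → y ≢ x → ¬ Supports y x

  -- A minimal piece is a source, and being a source is decidable, so a source can be found.
  opaque
    source : ∃[ x ] IsSource x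
    source with any? (λ x → all? λ y → ¬? (y ≟ x) →-dec ¬? (supports? y x))
    ... | yes s      = s
    ... | no nosource = ⊥-elim (¬¬-decidable λ ⊑-dec →
            let (z , _ , z-min) = Decided.minimal-below ⊑-dec zero
            in nosource (z , λ y y≢z s → y≢z (z-min y (proj₂ s))))

  x : Fin (suc k)
  x = proj₁ source

  -- A piece strictly below x would give a cover of x, i.e. a concurrent support.
  x-minimal : IsMinimal (toHeap X) x
  x-minimal y y⊑x = decidable-stable (y ≟ x) λ y≢x → ¬¬-decidable λ ⊑-dec →
    let (z , _ , z⋖x) = Decided.cover-below ⊑-dec (y⊑x , y≢x)
    in proj₂ source z (proj₁ (proj₂ z⋖x)) (covering z x z⋖x , proj₁ z⋖x)

  ι : Fin k → Fin (suc k)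
  ι = punchIn x

  x≢ι : ∀ i → x ≢ ι i
  x≢ι i x≡ιi = punchInᵢ≢i x i (sym x≡ιi)

  ι-not-below-x : ∀ i → ¬ ι i ⊑ x
  ι-not-below-x i ιi⊑x = x≢ι i (sym (x-minimal (ι i) ιi⊑x))

  x-or-ι : ∀ y → x ≡ y ⊎ ∃[ i ] ι i ≡ y
  x-or-ι y with x ≟ y
  ... | yes x≡y = inj₁ x≡y
  ... | no x≢y  = inj₂ (punchOut x≢y , punchIn-punchOut x≢y)

  covering-rest : ∀ i j → Covers (λ i j → ι i ⊑ ι j) i j → Concurrent (label (ι i)) (label (ι j))
  covering-rest i j (ιi⊑ιj , i≢j , between) = covering (ι i) (ι j) (ιi⊑ιj , i≢j ∘ punchIn-injective x i j , between′)
    where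
    between′ : ∀ c → ι i ⊑ c → c ⊑ ι j → c ≡ ι i ⊎ c ≡ ι j
    between′ c ιi⊑c c⊑ιj with x-or-ι c
    ... | inj₁ refl       = ⊥-elim (ι-not-below-x i ιi⊑c)
    ... | inj₂ (c′ , refl) = Sum.map (cong ι) (cong ι) (between c′ ιi⊑c c⊑ιj)

  rest : HeapOn k
  rest = record
    { label      = label ∘ ι
    ; _⊑_        = λ i j → ι i ⊑ ι j
    ; ⊑-refl     = ⊑-refl ∘ ι
    ; ⊑-antisym  = λ i j p q → punchIn-injective x i j (⊑-antisym (ι i) (ι j) p q)
    ; ⊑-trans    = λ i j l → ⊑-trans (ι i) (ι j) (ι l)
    ; comparable = λ i j → comparable (ι i) (ι j)
    ; covering   = covering-rest
    }

  -- If x ⊑ ι j then a cover of x lies below ι j, and covers are concurrent; the goal being decidable,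
  -- this cover need only exist classically.
  x-below : ∀ {w} (I : Iso (toHeap rest) (heapOf w)) j → x ⊑ ι j → Below (label x ∷ w) zero (suc (proj₁ I j))
  x-below {w} (σ , _ , _ , _ , order , label′) j x⊑ιj =
    decidable-stable (below? (label x ∷ w) zero (suc (σ j))) λ ¬below → ¬¬-decidable λ ⊑-dec →
      let (z , x⋖z , z⊑ιj) = Decided.cover-above ⊑-dec (x⊑ιj , x≢ι j)
      in ¬below (through z x⋖z z⊑ιj)
    where
    through : ∀ z → Covers _⊑_ x z → z ⊑ ι j → Below (label x ∷ w) zero (suc (σ j))
    through z x⋖z z⊑ιj with x-or-ι z
    ... | inj₁ refl      = ⊥-elim (proj₁ (proj₂ x⋖z) refl)
    ... | inj₂ (t , refl) =
      σ t , subst (Concurrent (label x)) (sym (label′ t)) (covering x (ι t) x⋖z) , proj₁ (order t j) z⊑ιj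

  below-x : ∀ {w} (I : Iso (toHeap rest) (heapOf w)) j → Below (label x ∷ w) zero (suc (proj₁ I j)) → x ⊑ ι j
  below-x {w} (σ , τ , _ , στ , order , label′) j (i , x~i , i≤σj) =
    Sum.[ (λ x⊑ιτi → ⊑-trans x (ι (τ i)) (ι j) x⊑ιτi (proj₂ (order (τ i) j) τi≤j)) ,
          (λ ιτi⊑x → ⊥-elim (ι-not-below-x (τ i) ιτi⊑x)) ]′
      (comparable x (ι (τ i)) (subst (Concurrent (label x)) (trans (cong (lookup w) (sym (στ i))) (label′ (τ i))) x~i))
    where
    τi≤j : Below w (σ (τ i)) (σ j)
    τi≤j = subst (λ z → Below w z (σ j)) (sym (στ i)) i≤σj

  extend : ∀ {w} → Iso (toHeap rest) (heapOf w) → Iso (toHeap X) (heapOf (label x ∷ w))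
  extend {w} I@(σ , _ , _ , _ , order , label′) = isoVia {toHeap X} {heapOf W} π order-π label-π
    where
    W = label x ∷ w
    π = insert x zero (Iso⇒Permutation {toHeap rest} {heapOf w} I)

    π-x : π ⟨$⟩ʳ x ≡ zero
    π-x = insert-at-i x zero _

    π-ι : ∀ i → π ⟨$⟩ʳ ι i ≡ suc (σ i)
    π-ι = insert-punchIn x zero _

    order-π : ∀ y y′ → (y ⊑ y′ → Below W (π ⟨$⟩ʳ y) (π ⟨$⟩ʳ y′)) × (Below W (π ⟨$⟩ʳ y) (π ⟨$⟩ʳ y′) → y ⊑ y′)
    order-π y y′ with x-or-ι y | x-or-ι y′
    ... | inj₁ refl       | inj₁ refl        = (λ _ → subst (λ z → Below W z z) (sym π-x) tt) , (λ _ → ⊑-refl x)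
    ... | inj₁ refl       | inj₂ (j , refl) =
      subst₂ (Below W) (sym π-x) (sym (π-ι j)) ∘ x-below {w} I j , below-x {w} I j ∘ subst₂ (Below W) π-x (π-ι j)
    ... | inj₂ (i , refl) | inj₁ refl        =
      ⊥-elim ∘ ι-not-below-x i , λ ιi≤x → ⊥-elim (subst₂ (Below W) (π-ι i) π-x ιi≤x)
    ... | inj₂ (i , refl) | inj₂ (j , refl) =
      subst₂ (Below W) (sym (π-ι i)) (sym (π-ι j)) ∘ proj₁ (order i j) ,
      proj₂ (order i j) ∘ subst₂ (Below W) (π-ι i) (π-ι j)

    label-π : ∀ y → lookup W (π ⟨$⟩ʳ y) ≡ label y
    label-π y with x-or-ι y
    ... | inj₁ refl       = cong (lookup W) π-x
    ... | inj₂ (i , refl) = trans (cong (lookup W) (π-ι i)) (label′ i)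

linearize : ∀ {k} (X : HeapOn k) → ∃[ w ] Iso (toHeap X) (heapOf w)
linearize {zero}  X = [] , (λ ()) , (λ ()) , (λ ()) , (λ ()) , (λ ()) , (λ ())
linearize {suc k} X with linearize (Peel.rest X)
... | w , I = HeapOn.label X (Peel.x X) ∷ w , Peel.extend X I

-- The heap of a word

-- The number of d's of w not matched inside w.
pending : List Bool → ℕ
pending []          = 0
pending (true ∷ w)  = pred (pending w)
pending (false ∷ w) = suc (pending w)

monoIfZero : ℕ → List Piece → List Piece
monoIfZero zero    ps = mono ∷ ps
monoIfZero (suc _) ps = ps

lookup-monoIfZero : ∀ {P : Piece → Set} n ps → P mono → (∀ i → P (lookup ps i)) → ∀ i → P (lookup (monoIfZero n ps) i)
lookup-monoIfZero zero    ps P-mono P-ps zero    = P-mono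
lookup-monoIfZero zero    ps P-mono P-ps (suc i) = P-ps i
lookup-monoIfZero (suc _) ps P-mono P-ps i       = P-ps i

-- The heap of a word, listed bottom-up: a d followed by p pending d's is the dimer [p+1, p+2]
-- (for a matching, p is the number of arches enclosing its arch), a half-arch is a monomer,
-- and a u closing an arch adds nothing.
pieces : List Bool → List Piece
pieces []          = []
pieces (true ∷ w)  = monoIfZero (pending w) (pieces w)
pieces (false ∷ w) = dimer (pending w) ∷ pieces w

pieces-true-unmatched : ∀ w → pending w ≡ 0 → pieces (true ∷ w) ≡ mono ∷ pieces w
pieces-true-unmatched w eq = cong (λ p → monoIfZero p (pieces w)) eq

pieces-true-closing : ∀ w {p} → pending w ≡ suc p → pieces (true ∷ w) ≡ pieces w
pieces-true-closing w eq = cong (λ p → monoIfZero p (pieces w)) eq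

prefixOK⇒pending≤ : ∀ h C → T (prefixOK h C) → pending C ≤ h
prefixOK⇒pending≤ h       []          _  = z≤n
prefixOK⇒pending≤ h       (true ∷ C)  ok = ℕ.pred-mono-≤ (prefixOK⇒pending≤ (suc h) C ok)
prefixOK⇒pending≤ (suc h) (false ∷ C) ok = s≤s (prefixOK⇒pending≤ h C ok)

pending≤⇒prefixOK : ∀ h C → pending C ≤ h → T (prefixOK h C)
pending≤⇒prefixOK h       []          _         = tt
pending≤⇒prefixOK h       (true ∷ C)  p≤h       =
  pending≤⇒prefixOK (suc h) C (ℕ.≤-trans (n≤1+pred[n] (pending C)) (s≤s p≤h))
pending≤⇒prefixOK (suc h) (false ∷ C) (s≤s p≤h) = pending≤⇒prefixOK h C p≤h

DimersDescend : List Piece → Set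
DimersDescend w = ∀ i {j} → lookup w i ≡ dimer (suc j) → ∃[ i′ ] lookup w i′ ≡ dimer j × Below w i i′

-- Every piece climbs, through dimers of decreasing abscissa, to one of abscissa 1,
-- and pieces of abscissa 1 are all comparable with the top piece.
Admissible-pyramid : ∀ a w → left (lookup (a ∷ w) (fromℕ (length w))) ≡ 1 → DimersDescend (a ∷ w) →
                     Admissible (heapOf (a ∷ w))
Admissible-pyramid a w top-left descend =
  inj₂ (top , top-maximal a w , (λ m m-max → sym (m-max top (below-top m))) , top-left)
  where
  W = a ∷ w
  top = fromℕ (length w)

  ground : ∀ i → left (lookup W i) ≡ 1 → Below W i top
  ground i left≡1 with Below-comparable W i top (left≡1⇒concurrent left≡1 top-left)
  ... | inj₁ i≤top = i≤top
  ... | inj₂ top≤i = subst (λ z → Below W z top) (sym (top-maximal a w i top≤i)) (Below-refl W top)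

  climb : ∀ j i → lookup W i ≡ dimer j → Below W i top
  climb zero    i eq = ground i (cong left eq)
  climb (suc j) i eq with descend i eq
  ... | i′ , eq′ , i≤i′ = Below-trans W i i′ top i≤i′ (climb j i′ eq′)

  below-top : ∀ i → Below W i top
  below-top i with lookup W i in eq
  ... | mono    = ground i (cong left eq)
  ... | dimer j = climb j i eq

pieces-dimer : ∀ R {j} → j < pending R → ∃[ i ] lookup (pieces R) i ≡ dimer j
pieces-dimer (false ∷ R) {j} (s≤s j≤p) with ℕ.m≤n⇒m<n∨m≡n j≤p
... | inj₁ j<p  = let (i , eq) = pieces-dimer R j<p in suc i , eq
... | inj₂ refl = zero , refl
pieces-dimer (true ∷ R) {j} j<p with pending R in eq
... | suc q = pieces-dimer R (subst (suc j ≤_) (sym eq) (ℕ.m≤n⇒m≤1+n j<p))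

DimersDescend-mono∷ : ∀ {ps} → DimersDescend ps → DimersDescend (mono ∷ ps)
DimersDescend-mono∷ descend (suc i) eq with descend i eq
... | i′ , eq′ , i≤i′ = suc i′ , eq′ , i≤i′

pieces-descend : ∀ S → DimersDescend (pieces S)
pieces-descend (true ∷ R) with pending R
... | zero  = DimersDescend-mono∷ (pieces-descend R)
... | suc _ = pieces-descend R
pieces-descend (false ∷ R) zero {j} eq with pieces-dimer R {j} (ℕ.≤-reflexive (sym (dimer-injective eq)))
... | i , eq′ =
  suc i , eq′ , i , subst₂ Concurrent (sym eq) (sym eq′) (dimer-suc-concurrent j) , Below-refl (pieces R) i
pieces-descend (false ∷ R) (suc i) eq with pieces-descend R i eq
... | i′ , eq′ , i≤i′ = suc i′ , eq′ , i≤i′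

pieces-top : ∀ b S → ∃[ a ] ∃[ w ] pieces (b ∷ S) ≡ a ∷ w × left (lookup (a ∷ w) (fromℕ (length w))) ≡ 1
pieces-top true  []      = mono , [] , refl , refl
pieces-top false []      = dimer 0 , [] , refl , refl
pieces-top false (b ∷ S) with pieces-top b S
... | a , w , eq , top-left = dimer (pending (b ∷ S)) , a ∷ w , cong (dimer (pending (b ∷ S)) ∷_) eq , top-left
pieces-top true  (b ∷ S) with pending (b ∷ S) | pieces-top b S
... | zero  | a , w , eq , top-left = mono , a ∷ w , cong (mono ∷_) eq , top-left
... | suc _ | top                  = top

pieces-admissible : ∀ S → Admissible (heapOf (pieces S))
pieces-admissible []      = inj₁ refl
pieces-admissible (b ∷ S) with pieces (b ∷ S) | pieces-descend (b ∷ S) | pieces-top b S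
... | _ | descend | a , w , refl , top-left = Admissible-pyramid a w top-left descend

xExp-heapOf : ∀ w → xExp (heapOf w) ≡ length w
xExp-heapOf []            = refl
xExp-heapOf (mono ∷ w)    = trans (ℕ.+-suc _ _) (cong suc (xExp-heapOf w))
xExp-heapOf (dimer _ ∷ w) = cong suc (xExp-heapOf w)

yExp-pieces : ∀ S → yExp (heapOf (pieces S)) ≡ length S + pending S
yExp-pieces []          = refl
yExp-pieces (false ∷ R) = begin
  2 * suc D + M              ≡⟨ cong (_+ M) (ℕ.*-suc 2 D) ⟩
  2 + (2 * D + M)            ≡⟨ cong (2 +_) (yExp-pieces R) ⟩
  2 + (length R + pending R) ≡⟨ cong suc (ℕ.+-suc _ _) ⟨
  suc (length R) + suc (pending R) ∎
  where
  open ≡-Reasoning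
  D = Ndim (heapOf (pieces R))
  M = Nmono (heapOf (pieces R))
yExp-pieces (true ∷ R) with pending R | yExp-pieces R
... | zero  | yExp≡ = trans (ℕ.+-suc _ _) (cong suc yExp≡)
... | suc _ | yExp≡ = trans yExp≡ (ℕ.+-suc _ _)

-- Arches and the statistics of the heap of a word

pendingPositions : List Bool → List ℕ
pendingPositions []          = []
pendingPositions (true ∷ w)  = map suc (drop 1 (pendingPositions w))
pendingPositions (false ∷ w) = 0 ∷ map suc (pendingPositions w)

length-pendingPositions : ∀ w → length (pendingPositions w) ≡ pending w
length-pendingPositions []          = refl
length-pendingPositions (true ∷ w) with pendingPositions w | length-pendingPositions w
... | []     | length≡ = cong pred length≡
... | q ∷ qs | length≡ = trans (length-map suc qs) (cong pred length≡)
length-pendingPositions (false ∷ w) =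
  cong suc (trans (length-map suc (pendingPositions w)) (length-pendingPositions w))

pendingPositions-bounded : ∀ w → All (_< length w) (pendingPositions w)
pendingPositions-bounded []          = []
pendingPositions-bounded (true ∷ w)  = All.map⁺ (All.map s≤s (All.drop⁺ 1 (pendingPositions-bounded w)))
pendingPositions-bounded (false ∷ w) = s≤s z≤n ∷ All.map⁺ (All.map s≤s (pendingPositions-bounded w))

pendingPositions-increasing : ∀ w → AllPairs _<_ (pendingPositions w)
pendingPositions-increasing []          = []
pendingPositions-increasing (true ∷ w)  =
  AllPairs.map⁺ (AllPairs.map s≤s (AllPairs.drop⁺ 1 (pendingPositions-increasing w)))
pendingPositions-increasing (false ∷ w) =
  All.map⁺ (All.universal (λ _ → s≤s z≤n) _) ∷ AllPairs.map⁺ (AllPairs.map s≤s (pendingPositions-increasing w))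

entryIs : List ℕ → ℕ → ℕ → Bool
entryIs []       _       _ = false
entryIs (q ∷ qs) zero    j = q ≡ᵇ j
entryIs (q ∷ qs) (suc h) j = entryIs qs h j

entryIs-map-suc : ∀ qs h j → entryIs (map suc qs) h (suc j) ≡ entryIs qs h j
entryIs-map-suc []       h       j = refl
entryIs-map-suc (q ∷ qs) zero    j = refl
entryIs-map-suc (q ∷ qs) (suc h) j = entryIs-map-suc qs h j

entryIs-map-suc-0 : ∀ qs h → entryIs (map suc qs) h 0 ≡ false
entryIs-map-suc-0 []       h       = refl
entryIs-map-suc-0 (q ∷ qs) zero    = refl
entryIs-map-suc-0 (q ∷ qs) (suc h) = entryIs-map-suc-0 qs h

entryIs-drop1 : ∀ qs h j → entryIs (drop 1 qs) h j ≡ entryIs qs (suc h) j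
entryIs-drop1 []       h j = refl
entryIs-drop1 (q ∷ qs) h j = refl

closesAt : List Bool → ℕ → ℕ → Bool
closesAt w h j = (j <ᵇ length w) ∧ (not (nth w j) ∧ balanced h (take j w))

closesAt≡entryIs : ∀ w h j → closesAt w h j ≡ entryIs (pendingPositions w) h j
closesAt≡entryIs []          h       j       = refl
closesAt≡entryIs (false ∷ w) zero    zero    = refl
closesAt≡entryIs (false ∷ w) (suc h) zero    = sym (entryIs-map-suc-0 (pendingPositions w) h)
closesAt≡entryIs (false ∷ w) zero    (suc j) =
  trans (cong ((j <ᵇ length w) ∧_) (Bool.∧-zeroʳ (not (nth w j)))) (Bool.∧-zeroʳ (j <ᵇ length w))
closesAt≡entryIs (false ∷ w) (suc h) (suc j) =
  trans (closesAt≡entryIs w h j) (sym (entryIs-map-suc (pendingPositions w) h j))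
closesAt≡entryIs (true ∷ w)  h       zero    = sym (entryIs-map-suc-0 (drop 1 (pendingPositions w)) h)
closesAt≡entryIs (true ∷ w)  h       (suc j) = begin
  closesAt w (suc h) j                                    ≡⟨ closesAt≡entryIs w (suc h) j ⟩
  entryIs (pendingPositions w) (suc h) j                  ≡⟨ entryIs-drop1 (pendingPositions w) h j ⟨
  entryIs (drop 1 (pendingPositions w)) h j               ≡⟨ entryIs-map-suc (drop 1 (pendingPositions w)) h j ⟨
  entryIs (map suc (drop 1 (pendingPositions w))) h (suc j) ∎
  where open ≡-Reasoning

shiftArch : ℕ × ℕ → ℕ × ℕ
shiftArch (i , j) = suc i , suc j

enclosesShifted : ℕ × ℕ → ℕ × ℕ → Bool
enclosesShifted a n = encloses n (shiftArch a)

archAt : List Bool → ℕ → ℕ → List (ℕ × ℕ)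
archAt w i j = if matchedᵇ w i j then (i , j) ∷ [] else []

archesFrom : List Bool → ℕ → List (ℕ × ℕ)
archesFrom w i = concatMap (archAt w i) (upTo (length w))

archAt-suc : ∀ b w i j → archAt (b ∷ w) (suc i) (suc j) ≡ map shiftArch (archAt w i j)
archAt-suc b w i j with matchedᵇ w i j
... | true  = refl
... | false = refl

archesFrom-suc : ∀ b w i → archesFrom (b ∷ w) (suc i) ≡ map shiftArch (archesFrom w i)
archesFrom-suc b w i =
  trans (concatMap-upTo-suc (archAt (b ∷ w) (suc i)) (length w))
        (trans (concatMap-cong (archAt-suc b w i) (upTo (length w)))
               (concatMap-map-out shiftArch (archAt w i) (upTo (length w))))

arches-∷ : ∀ b w → arches (b ∷ w) ≡ archesFrom (b ∷ w) 0 ++ map shiftArch (arches w)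
arches-∷ b w =
  trans (concatMap-upTo-suc (archesFrom (b ∷ w)) (length w))
        (cong (archesFrom (b ∷ w) 0 ++_)
              (trans (concatMap-cong (archesFrom-suc b w) (upTo (length w)))
                     (concatMap-map-out shiftArch (archesFrom w) (upTo (length w)))))

arches-false : ∀ w → arches (false ∷ w) ≡ map shiftArch (arches w)
arches-false w = trans (arches-∷ false w) (cong (_++ map shiftArch (arches w)) noneFrom0)
  where
  noneFrom0 : archesFrom (false ∷ w) 0 ≡ []
  noneFrom0 = trans (concatMap-upTo-suc (archAt (false ∷ w) 0) (length w))
                    (concatMap-[] _ (upTo (length w))
                       λ j → cong (λ c → if c then (0 , suc j) ∷ [] else []) (Bool.∧-zeroʳ (j <ᵇ length w)))

-- A leading u is matched with the first pending d of w, if there is one.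
leadingArch : List ℕ → List (ℕ × ℕ)
leadingArch []      = []
leadingArch (q ∷ _) = (0 , suc q) ∷ []

archesFrom-true : ∀ w → archesFrom (true ∷ w) 0 ≡ leadingArch (pendingPositions w)
archesFrom-true w =
  trans (concatMap-upTo-suc (archAt (true ∷ w) 0) (length w))
        (trans (concatMap-cong (λ j → cong (λ c → if c then (0 , suc j) ∷ [] else []) (closesAt≡entryIs w 0 j))
                               (upTo (length w)))
               (first (pendingPositions w) (pendingPositions-bounded w)))
  where
  first : ∀ qs → All (_< length w) qs →
          concatMap (λ j → if entryIs qs 0 j then (0 , suc j) ∷ [] else []) (upTo (length w)) ≡ leadingArch qs
  first []       _         = concatMap-[] _ (upTo (length w)) λ _ → refl
  first (q ∷ qs) (q<n ∷ _) = concatMap-pick q (λ j → 0 , suc j) (length w) q<n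

arches-true : ∀ w → arches (true ∷ w) ≡ leadingArch (pendingPositions w) ++ map shiftArch (arches w)
arches-true w = trans (arches-∷ true w) (cong (_++ map shiftArch (arches w)) (archesFrom-true w))

arches-true-none : ∀ w → pendingPositions w ≡ [] → arches (true ∷ w) ≡ map shiftArch (arches w)
arches-true-none w none = trans (arches-true w) (cong (λ qs → leadingArch qs ++ map shiftArch (arches w)) none)

arches-true-some : ∀ w {q qs} → pendingPositions w ≡ q ∷ qs →
                   arches (true ∷ w) ≡ (0 , suc q) ∷ map shiftArch (arches w)
arches-true-some w some = trans (arches-true w) (cong (λ qs → leadingArch qs ++ map shiftArch (arches w)) some)

isHalf : List Bool → ℕ → Bool
isHalf w i = nth w i ∧ not (any (matchedᵇ w i) (upTo (length w)))

halfArches-tail : ∀ b w → filterᵇ (isHalf (b ∷ w)) (map suc (upTo (length w))) ≡ map suc (halfArches w)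
halfArches-tail b w =
  trans (filterᵇ-map (isHalf (b ∷ w)) suc (upTo (length w)))
        (cong (map suc) (filterᵇ-cong isHalf-suc (upTo (length w))))
  where
  isHalf-suc : ∀ i → isHalf (b ∷ w) (suc i) ≡ isHalf w i
  isHalf-suc i = cong (λ c → nth w i ∧ not c)
    (trans (cong (any (matchedᵇ (b ∷ w) (suc i))) (upTo-suc (length w)))
           (any-map (matchedᵇ (b ∷ w) (suc i)) suc (upTo (length w))))

halfArches-∷ : ∀ b w → halfArches (b ∷ w) ≡
               (if isHalf (b ∷ w) 0 then 0 ∷ map suc (halfArches w) else map suc (halfArches w))
halfArches-∷ b w =
  trans (cong (filterᵇ (isHalf (b ∷ w))) (upTo-suc (length w)))
        (trans (filterᵇ-∷ (isHalf (b ∷ w)) 0 (map suc (upTo (length w))))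
               (cong (λ t → if isHalf (b ∷ w) 0 then 0 ∷ t else t) (halfArches-tail b w)))

halfArches-false : ∀ w → halfArches (false ∷ w) ≡ map suc (halfArches w)
halfArches-false w = halfArches-∷ false w

isHalf-true : ∀ w → isHalf (true ∷ w) 0 ≡ not (any (entryIs (pendingPositions w) 0) (upTo (length w)))
isHalf-true w = cong not
  (trans (cong (any (matchedᵇ (true ∷ w) 0)) (upTo-suc (length w)))
         (trans (any-map (matchedᵇ (true ∷ w) 0) suc (upTo (length w)))
                (any-cong (closesAt≡entryIs w 0) (upTo (length w)))))

halfArches-true-none : ∀ w → pendingPositions w ≡ [] → halfArches (true ∷ w) ≡ 0 ∷ map suc (halfArches w)
halfArches-true-none w none =
  trans (halfArches-∷ true w)
        (cong (λ c → if c then 0 ∷ map suc (halfArches w) else map suc (halfArches w)) unmatched)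
  where
  unmatched : isHalf (true ∷ w) 0 ≡ true
  unmatched = trans (isHalf-true w)
    (cong not (trans (cong (λ qs → any (entryIs qs 0) (upTo (length w))) none) (any-false (upTo (length w)))))

halfArches-true-some : ∀ w {q qs} → pendingPositions w ≡ q ∷ qs → halfArches (true ∷ w) ≡ map suc (halfArches w)
halfArches-true-some w {q} some =
  trans (halfArches-∷ true w)
        (cong (λ c → if c then 0 ∷ map suc (halfArches w) else map suc (halfArches w)) matched)
  where
  q<n : q < length w
  q<n = All.head (subst (All (_< length w)) some (pendingPositions-bounded w))
  matched : isHalf (true ∷ w) 0 ≡ false
  matched = trans (isHalf-true w)
    (cong not (trans (cong (λ qs → any (entryIs qs 0) (upTo (length w))) some) (any-pick q (length w) q<n)))

archCount-false : ∀ w → archCount (false ∷ w) ≡ archCount w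
archCount-false w = cong₂ _+_ (trans (cong length (arches-false w)) (length-map shiftArch (arches w)))
                              (trans (cong length (halfArches-false w)) (length-map suc (halfArches w)))

archCount-true : ∀ w → archCount (true ∷ w) ≡ suc (archCount w)
archCount-true w with pendingPositions w in eq
... | [] =
  trans (cong₂ _+_ (trans (cong length (arches-true-none w eq)) (length-map shiftArch (arches w)))
                   (trans (cong length (halfArches-true-none w eq)) (cong suc (length-map suc (halfArches w)))))
        (ℕ.+-suc _ _)
... | q ∷ qs = cong₂ _+_ (trans (cong length (arches-true-some w eq)) (cong suc (length-map shiftArch (arches w))))
                         (trans (cong length (halfArches-true-some w eq)) (length-map suc (halfArches w)))

archWeight-shiftArch : ∀ b w N → arches (b ∷ w) ≡ N ++ map shiftArch (arches w) → ∀ a →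
                       archWeight (b ∷ w) (shiftArch a) ≡ length (filterᵇ (enclosesShifted a) N) + archWeight w a
archWeight-shiftArch b w N eq a = begin
  suc (length (filterᵇ (enclosesShifted a) (arches (b ∷ w))))
    ≡⟨ cong (suc ∘ length) (trans (cong (filterᵇ (enclosesShifted a)) eq) (filter-++ (T? ∘ enclosesShifted a) N _)) ⟩
  suc (length (filterᵇ (enclosesShifted a) N ++ filterᵇ (enclosesShifted a) (map shiftArch (arches w))))
    ≡⟨ cong suc (length-++ (filterᵇ (enclosesShifted a) N)) ⟩
  suc (L + length (filterᵇ (enclosesShifted a) (map shiftArch (arches w))))
    ≡⟨ cong (λ l → suc (L + length l)) (filterᵇ-map (enclosesShifted a) shiftArch (arches w)) ⟩
  suc (L + length (map shiftArch (filterᵇ (λ a′ → encloses a′ a) (arches w))))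
    ≡⟨ cong (λ l → suc (L + l)) (length-map shiftArch (filterᵇ (λ a′ → encloses a′ a) (arches w))) ⟩
  suc (L + length (filterᵇ (λ a′ → encloses a′ a) (arches w)))
    ≡⟨ ℕ.+-suc L _ ⟨
  L + archWeight w a ∎
  where
  open ≡-Reasoning
  L = length (filterᵇ (enclosesShifted a) N)

archSum : List Bool → ℕ
archSum w = sumₗ (map (archWeight w) (arches w))

archSum-shifted : ∀ b w → arches (b ∷ w) ≡ map shiftArch (arches w) → archSum (b ∷ w) ≡ archSum w
archSum-shifted b w eq =
  trans (cong (sumₗ ∘ map (archWeight (b ∷ w))) eq)
        (cong sumₗ (trans (sym (map-∘ (arches w))) (map-cong (archWeight-shiftArch b w [] eq) (arches w))))

archesBefore : List Bool → ℕ → ℕ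
archesBefore w q = length (filterᵇ (λ a → proj₂ a <ᵇ q) (arches w))

-- The new arch has weight 1 and encloses exactly the arches of w ending before q.
archSum-leading : ∀ w {q} → arches (true ∷ w) ≡ (0 , suc q) ∷ map shiftArch (arches w) →
                  archSum (true ∷ w) ≡ suc (archesBefore w q + archSum w)
archSum-leading w {q} eq = begin
  sumₗ (map (archWeight (true ∷ w)) (arches (true ∷ w)))
    ≡⟨ cong (sumₗ ∘ map (archWeight (true ∷ w))) eq ⟩
  archWeight (true ∷ w) (0 , suc q) + sumₗ (map (archWeight (true ∷ w)) (map shiftArch (arches w)))
    ≡⟨ cong₂ _+_ (cong (suc ∘ length) (filterᵇ-false (arches (true ∷ w))))
                 (cong sumₗ (trans (sym (map-∘ (arches w))) (map-cong shifted (arches w)))) ⟩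
  suc (sumₗ (map (λ a → (if proj₂ a <ᵇ q then 1 else 0) + archWeight w a) (arches w)))
    ≡⟨ cong suc (sum-indicator (λ a → proj₂ a <ᵇ q) (archWeight w) (arches w)) ⟩
  suc (archesBefore w q + archSum w) ∎
  where
  open ≡-Reasoning
  shifted : ∀ a → archWeight (true ∷ w) (shiftArch a) ≡ (if proj₂ a <ᵇ q then 1 else 0) + archWeight w a
  shifted a = trans (archWeight-shiftArch true w ((0 , suc q) ∷ []) eq a)
                    (cong (_+ archWeight w a) (length-filterᵇ-singleton (enclosesShifted a) (0 , suc q)))

weight-false : ∀ w → weight (false ∷ w) ≡ weight w
weight-false w = cong₂ _+_ (archSum-shifted false w (arches-false w))
                           (trans (cong length (halfArches-false w)) (length-map suc (halfArches w)))

weight-true-none : ∀ w → pendingPositions w ≡ [] → weight (true ∷ w) ≡ suc (weight w)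
weight-true-none w none =
  trans (cong₂ _+_ (archSum-shifted true w (arches-true-none w none))
                   (trans (cong length (halfArches-true-none w none)) (cong suc (length-map suc (halfArches w)))))
        (ℕ.+-suc _ _)

weight-true-some : ∀ w {q qs} → pendingPositions w ≡ q ∷ qs → weight (true ∷ w) ≡ suc (archesBefore w q + weight w)
weight-true-some w {q} some =
  trans (cong₂ _+_ (archSum-leading w (arches-true-some w some))
                   (trans (cong length (halfArches-true-some w some)) (length-map suc (halfArches w))))
        (cong suc (ℕ.+-assoc (archesBefore w q) (archSum w) _))

archesBefore-false : ∀ w q → archesBefore (false ∷ w) q ≡ length (filterᵇ (λ a → suc (proj₂ a) <ᵇ q) (arches w))
archesBefore-false w q =
  trans (cong (length ∘ filterᵇ (λ a → proj₂ a <ᵇ q)) (arches-false w))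
        (trans (cong length (filterᵇ-map (λ a → proj₂ a <ᵇ q) shiftArch (arches w)))
               (length-map shiftArch (filterᵇ (λ a → suc (proj₂ a) <ᵇ q) (arches w))))

archesBefore-leading : ∀ w {q q′} → arches (true ∷ w) ≡ (0 , suc q) ∷ map shiftArch (arches w) → q < q′ →
                       archesBefore (true ∷ w) (suc q′) ≡ suc (archesBefore w q′)
archesBefore-leading w {q} {q′} eq q<q′ =
  trans (cong (length ∘ filterᵇ before) eq)
        (trans (cong length (filter-accept (T? ∘ before) {x = 0 , suc q} {xs = map shiftArch (arches w)} (ℕ.<⇒<ᵇ q<q′)))
               (cong suc (trans (cong length (filterᵇ-map before shiftArch (arches w)))
                                 (length-map shiftArch (filterᵇ (before ∘ shiftArch) (arches w))))))
  where
  before = λ (a : ℕ × ℕ) → proj₂ a <ᵇ suc q′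

triangle : ℕ → ℕ
triangle zero    = 0
triangle (suc n) = suc n + triangle n

-- The abscissae of the pieces of w exceed weight w by those of the dimers of the pending d's,
-- triangle (pending w), plus one for each arch ending before some pending d.
excess : List Bool → ℕ
excess w = triangle (pending w) + sumₗ (map (archesBefore w) (pendingPositions w))

excess-false : ∀ w → excess (false ∷ w) ≡ suc (pending w) + excess w
excess-false w = begin
  suc (pending w) + triangle (pending w) +
    (archesBefore (false ∷ w) 0 + sumₗ (map (archesBefore (false ∷ w)) (map suc (pendingPositions w))))
    ≡⟨ cong₂ (λ x y → suc (pending w) + triangle (pending w) + (x + y))
             (trans (archesBefore-false w 0) (cong length (filterᵇ-false (arches w))))
             (cong sumₗ (trans (sym (map-∘ (pendingPositions w)))
                               (map-cong (archesBefore-false w ∘ suc) (pendingPositions w)))) ⟩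
  suc (pending w) + triangle (pending w) + sumₗ (map (archesBefore w) (pendingPositions w))
    ≡⟨ ℕ.+-assoc (suc (pending w)) _ _ ⟩
  suc (pending w) + excess w ∎
  where open ≡-Reasoning

excess-none : ∀ w → pendingPositions w ≡ [] → excess w ≡ 0
excess-none w none = cong₂ _+_ (cong triangle (trans (sym (length-pendingPositions w)) (cong length none)))
                               (cong (sumₗ ∘ map (archesBefore w)) none)

excess-some : ∀ w {q qs} → pendingPositions w ≡ q ∷ qs → excess w ≡ suc (archesBefore w q + excess (true ∷ w))
excess-some w {q} {qs} some = begin
  triangle (pending w) + sumₗ (map (archesBefore w) (pendingPositions w))
    ≡⟨ cong₂ (λ p qs′ → triangle p + sumₗ (map (archesBefore w) qs′)) pending≡ some ⟩
  triangle (suc l) + (archesBefore w q + sumₗ (map (archesBefore w) qs))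
    ≡⟨ rearrange l (triangle l) (archesBefore w q) (sumₗ (map (archesBefore w) qs)) ⟩
  suc (archesBefore w q + (triangle l + (l + sumₗ (map (archesBefore w) qs))))
    ≡⟨ cong (λ e → suc (archesBefore w q + (triangle l + e))) raised ⟨
  suc (archesBefore w q + (triangle l + sumₗ (map (archesBefore (true ∷ w)) (map suc qs))))
    ≡⟨ cong₂ (λ p qs′ → suc (archesBefore w q + (triangle p + sumₗ (map (archesBefore (true ∷ w)) qs′))))
             (cong pred pending≡) (cong (map suc ∘ drop 1) some) ⟨
  suc (archesBefore w q + excess (true ∷ w)) ∎
  where
  open ≡-Reasoning
  l = length qs
  pending≡ : pending w ≡ suc l
  pending≡ = trans (sym (length-pendingPositions w)) (cong length some)
  rearrange : ∀ l t a s → suc l + t + (a + s) ≡ suc (a + (t + (l + s)))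
  rearrange = solve-∀
  later : All (q <_) qs
  later = AllPairs.head (subst (AllPairs _<_) some (pendingPositions-increasing w))
  raised : sumₗ (map (archesBefore (true ∷ w)) (map suc qs)) ≡ l + sumₗ (map (archesBefore w) qs)
  raised = trans (cong sumₗ (trans (sym (map-∘ qs))
                                   (map-cong-local (All.map (archesBefore-leading w (arches-true-some w some)) later))))
                 (sum-suc (archesBefore w) qs)

length-pieces : ∀ S → length (pieces S) ≡ archCount S + pending S
length-pieces []          = refl
length-pieces (false ∷ w) =
  trans (cong suc (length-pieces w)) (trans (sym (ℕ.+-suc _ _)) (cong (_+ suc (pending w)) (sym (archCount-false w))))
length-pieces (true ∷ w) with pending w | length-pieces w
... | zero  | length≡ = trans (cong suc length≡) (cong (_+ 0) (sym (archCount-true w)))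
... | suc p | length≡ = trans length≡ (trans (ℕ.+-suc _ _) (cong (_+ p) (sym (archCount-true w))))

pExp-pieces : ∀ S → pExp (heapOf (pieces S)) ≡ weight S + excess S
pExp-pieces []          = refl
pExp-pieces (false ∷ w) = begin
  suc (pending w) + pExp (heapOf (pieces w))  ≡⟨ cong (suc (pending w) +_) (pExp-pieces w) ⟩
  suc (pending w) + (weight w + excess w)     ≡⟨ +-left-comm (suc (pending w)) (weight w) _ ⟩
  weight w + (suc (pending w) + excess w)     ≡⟨ cong₂ _+_ (weight-false w) (excess-false w) ⟨
  weight (false ∷ w) + excess (false ∷ w)     ∎
  where open ≡-Reasoning
pExp-pieces (true ∷ w) = byPending (pendingPositions w) refl
  where
  open ≡-Reasoning
  byPending : ∀ qs → pendingPositions w ≡ qs → pExp (heapOf (pieces (true ∷ w))) ≡ weight (true ∷ w) + excess (true ∷ w)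
  byPending [] none = begin
    pExp (heapOf (pieces (true ∷ w)))         ≡⟨ cong (pExp ∘ heapOf) (pieces-true-unmatched w pending≡0) ⟩
    suc (pExp (heapOf (pieces w)))            ≡⟨ cong suc (pExp-pieces w) ⟩
    suc (weight w + excess w)                 ≡⟨ cong (λ e → suc (weight w + e)) (excess-none w none) ⟩
    suc (weight w + 0)                        ≡⟨ cong₂ _+_ (weight-true-none w none)
                                                           (excess-none (true ∷ w) (cong (map suc ∘ drop 1) none)) ⟨
    weight (true ∷ w) + excess (true ∷ w)     ∎
    where
    pending≡0 : pending w ≡ 0
    pending≡0 = trans (sym (length-pendingPositions w)) (cong length none)
  byPending (q ∷ qs) some = begin
    pExp (heapOf (pieces (true ∷ w)))                     ≡⟨ cong (pExp ∘ heapOf) (pieces-true-closing w pending≡) ⟩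
    pExp (heapOf (pieces w))                              ≡⟨ pExp-pieces w ⟩
    weight w + excess w                                   ≡⟨ cong (weight w +_) (excess-some w some) ⟩
    weight w + suc (archesBefore w q + excess (true ∷ w)) ≡⟨ rearrange (weight w) (archesBefore w q) _ ⟩
    suc (archesBefore w q + weight w) + excess (true ∷ w) ≡⟨ cong (_+ excess (true ∷ w)) (weight-true-some w some) ⟨
    weight (true ∷ w) + excess (true ∷ w)                 ∎
    where
    pending≡ : pending w ≡ suc (length qs)
    pending≡ = trans (sym (length-pendingPositions w)) (cong length some)
    rearrange : ∀ u a e → u + suc (a + e) ≡ suc (a + u) + e
    rearrange = solve-∀

pendingPositions-none : ∀ C → pending C ≡ 0 → pendingPositions C ≡ []
pendingPositions-none C p≡0 with pendingPositions C | length-pendingPositions C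
... | []    | _ = refl
... | _ ∷ _ | length≡ with trans length≡ p≡0
... | ()

yExp-matching : ∀ C → pending C ≡ 0 → yExp (heapOf (pieces C)) ≡ length C
yExp-matching C p≡0 = trans (yExp-pieces C) (trans (cong (length C +_) p≡0) (ℕ.+-identityʳ (length C)))

xExp-matching : ∀ C → pending C ≡ 0 → xExp (heapOf (pieces C)) ≡ archCount C
xExp-matching C p≡0 =
  trans (xExp-heapOf (pieces C))
        (trans (length-pieces C) (trans (cong (archCount C +_) p≡0) (ℕ.+-identityʳ (archCount C))))

pExp-matching : ∀ C → pending C ≡ 0 → pExp (heapOf (pieces C)) ≡ weight C
pExp-matching C p≡0 =
  trans (pExp-pieces C)
        (trans (cong (weight C +_) (excess-none C (pendingPositions-none C p≡0))) (ℕ.+-identityʳ (weight C)))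

-- A matching is determined by its heap

-- The dimers of the pending d's of R climb from column pending R down to column 1, so every
-- piece within columns 1 .. pending R has one of them below it.
pieces-nonminimal : ∀ R i → right (lookup (pieces R) i) ≤ pending R → ∃[ i′ ] i′ ≢ i × Below (pieces R) i′ i
pieces-nonminimal (false ∷ R) zero    reach = ⊥-elim (ℕ.1+n≰n reach)
pieces-nonminimal (false ∷ R) (suc i) reach with ℕ.m≤n⇒m<n∨m≡n reach
... | inj₁ (s≤s within) =
  let (i′ , i′≢i , i′≤i) = pieces-nonminimal R i within in suc i′ , i′≢i ∘ suc-injective , i′≤i
... | inj₂ right≡       = zero , (λ ()) , i , touching , Below-refl (pieces R) i
  where
  touching : Concurrent (dimer (pending R)) (lookup (pieces R) i)
  touching = ℕ.≤-reflexive (sym right≡) , ℕ.≤-trans (proj₁ (concurrent-refl _)) (ℕ.≤-trans reach (ℕ.n≤1+n _))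
pieces-nonminimal (true ∷ R) i reach with pending R in eq
... | zero  = ⊥-elim (ℕ.<⇒≱ (1≤right _) reach)
... | suc q = pieces-nonminimal R i (subst (right (lookup (pieces R) i) ≤_) (sym eq) (ℕ.m≤n⇒m≤1+n reach))

bottom-outside : ∀ a w R → Iso (heapOf (a ∷ w)) (heapOf (pieces R)) → ¬ right a ≤ pending R
bottom-outside a w R I@(σ , _ , _ , _ , _ , label) reach
  with pieces-nonminimal R (σ zero) (subst (λ p → right p ≤ pending R) (sym (label zero)) reach)
... | i′ , i′≢σ0 , i′≤σ0 =
  i′≢σ0 (IsMinimal-Iso {heapOf (a ∷ w)} {heapOf (pieces R)} I (bottom-minimal a w) i′ i′≤σ0)

pending-Iso : ∀ S S′ → length S ≡ length S′ → Iso (heapOf (pieces S)) (heapOf (pieces S′)) → pending S ≡ pending S′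
pending-Iso S S′ len I = ℕ.+-cancelˡ-≡ (length S) _ _ (begin
  length S + pending S        ≡⟨ yExp-pieces S ⟨
  yExp (heapOf (pieces S))    ≡⟨ yExp-Iso {heapOf (pieces S)} {heapOf (pieces S′)} I ⟩
  yExp (heapOf (pieces S′))   ≡⟨ yExp-pieces S′ ⟩
  length S′ + pending S′      ≡⟨ cong (_+ pending S′) len ⟨
  length S + pending S′       ∎)
  where open ≡-Reasoning

dimer-vs-u : ∀ R R′ → length R ≡ length R′ → ¬ Iso (heapOf (pieces (false ∷ R))) (heapOf (pieces (true ∷ R′)))
dimer-vs-u R R′ len I with pending R′ in eq | pending-Iso (false ∷ R) (true ∷ R′) (cong suc len) I
... | suc q | pending≡ =
  bottom-outside (dimer (pending R)) (pieces R) R′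
                 (subst (Iso (heapOf (pieces (false ∷ R))) ∘ heapOf) (pieces-true-closing R′ eq) I)
                 (subst (suc (suc (pending R)) ≤_) (sym eq) (s≤s (ℕ.≤-reflexive pending≡)))

pieces-injective : ∀ S S′ → length S ≡ length S′ → Iso (heapOf (pieces S)) (heapOf (pieces S′)) → S ≡ S′
pieces-injective []          []           _   _ = refl
pieces-injective (false ∷ R) (false ∷ R′) len I =
  cong (false ∷_) (pieces-injective R R′ (ℕ.suc-injective len) (Iso-∷⁻¹ (dimer (pending R)) sameBottom))
  where
  sameBottom : Iso (heapOf (dimer (pending R) ∷ pieces R)) (heapOf (dimer (pending R) ∷ pieces R′))
  sameBottom = subst (λ p → Iso (heapOf (dimer (pending R) ∷ pieces R)) (heapOf (dimer p ∷ pieces R′)))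
                     (sym (ℕ.suc-injective (pending-Iso (false ∷ R) (false ∷ R′) len I))) I
pieces-injective (false ∷ R) (true ∷ R′)  len I = ⊥-elim (dimer-vs-u R R′ (ℕ.suc-injective len) I)
pieces-injective (true ∷ R)  (false ∷ R′) len I =
  ⊥-elim (dimer-vs-u R′ R (ℕ.suc-injective (sym len))
                    (Iso-sym {heapOf (pieces (true ∷ R))} {heapOf (pieces (false ∷ R′))} I))
pieces-injective (true ∷ R)  (true ∷ R′)  len I with pending R in eq | pending R′ in eq′
... | zero  | zero  = cong (true ∷_) (pieces-injective R R′ (ℕ.suc-injective len) (Iso-∷⁻¹ mono I))
... | suc _ | suc _ = cong (true ∷_) (pieces-injective R R′ (ℕ.suc-injective len) I)
... | zero  | suc _ = ⊥-elim (bottom-outside mono (pieces R) R′ I (subst (1 ≤_) (sym eq′) (s≤s z≤n)))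
... | suc _ | zero  =
  ⊥-elim (bottom-outside mono (pieces R′) R (Iso-sym {heapOf (pieces R)} {heapOf (mono ∷ pieces R′)} I)
                         (subst (1 ≤_) (sym eq) (s≤s z≤n)))

-- Every admissible heap is the heap of a matching

-- Some suffix of S has exactly k pending d's; a proof picks the longest one.
data Reaches (k : ℕ) : List Bool → Set where
  here  : ∀ {S} → pending S ≡ k → Reaches k S
  there : ∀ {b S} → pending (b ∷ S) ≢ k → Reaches k S → Reaches k (b ∷ S)

reaches? : ∀ k S → Dec (Reaches k S)
reaches? k S with pending S ℕ.≟ k
... | yes p≡k = yes (here p≡k)
reaches? k []      | no p≢k = no λ { (here p≡k) → p≢k p≡k }
reaches? k (b ∷ S) | no p≢k with reaches? k S
... | yes r  = yes (there p≢k r)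
... | no ¬r = no λ { (here p≡k) → p≢k p≡k ; (there _ r) → ¬r r }

insertArch : ∀ {k S} → Reaches k S → List Bool
insertArch {S = S}     (here _)    = true ∷ false ∷ S
insertArch {S = b ∷ _} (there _ r) = b ∷ insertArch r

pending-insertArch : ∀ {k S} (r : Reaches k S) → pending (insertArch r) ≡ pending S
pending-insertArch                 (here _)    = refl
pending-insertArch {S = true ∷ _}  (there _ r) = cong pred (pending-insertArch r)
pending-insertArch {S = false ∷ _} (there _ r) = cong suc (pending-insertArch r)

-- The pieces of the word up to the suffix all lie left of column k, so the dimer k slides past them.
Iso-insertArch : ∀ {k S} (r : Reaches k S) → pending S ≤ k →
                 Iso (heapOf (dimer k ∷ pieces S)) (heapOf (pieces (insertArch r)))
Iso-insertArch {S = S} (here p≡k) _ =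
  subst (λ p → Iso (heapOf (dimer p ∷ pieces S)) (heapOf (dimer (pending S) ∷ pieces S))) p≡k
        (Iso-refl {heapOf (dimer (pending S) ∷ pieces S)})
Iso-insertArch {k} {false ∷ S} (there p≢k r) p≤k rewrite pending-insertArch r =
  Iso-trans {heapOf (dimer k ∷ dimer (pending S) ∷ pieces S)} {heapOf (dimer (pending S) ∷ dimer k ∷ pieces S)}
            {heapOf (dimer (pending S) ∷ pieces (insertArch r))}
    (Iso-swap {dimer k} {dimer (pending S)} (pieces S) (right<left⇒¬concurrent (dimer k) (dimer (pending S)) (s≤s p<k)))
    (Iso-∷ (dimer (pending S)) (Iso-insertArch r (ℕ.<⇒≤ p≤k)))
  where
  p<k : suc (pending S) < k
  p<k = ℕ.≤∧≢⇒< p≤k p≢k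
Iso-insertArch {k} {true ∷ S} (there p≢k r) p≤k rewrite pending-insertArch r with pending S in eq
... | zero  = Iso-trans {heapOf (dimer k ∷ mono ∷ pieces S)} {heapOf (mono ∷ dimer k ∷ pieces S)}
                        {heapOf (mono ∷ pieces (insertArch r))}
                (Iso-swap {dimer k} {mono} (pieces S) (right<left⇒¬concurrent (dimer k) mono (s≤s (ℕ.≤∧≢⇒< p≤k p≢k))))
                (Iso-∷ mono (Iso-insertArch r (subst (_≤ k) (sym eq) z≤n)))
... | suc _ = Iso-insertArch r (subst (_≤ k) (sym eq) (ℕ.≤∧≢⇒< p≤k p≢k))

unreachable-left : ∀ k S → pending S < k → ¬ Reaches k S → ∀ i → right (lookup (pieces S) i) ≤ k
unreachable-left k (false ∷ S) p<k ¬r zero    = p<k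
unreachable-left k (false ∷ S) p<k ¬r (suc i) =
  unreachable-left k S (ℕ.<-trans (ℕ.n<1+n _) p<k) (¬r ∘ there (ℕ.<⇒≢ p<k)) i
unreachable-left k (true ∷ S)  p<k ¬r =
  lookup-monoIfZero {λ p → right p ≤ k} (pending S) (pieces S) (ℕ.≤-trans (s≤s z≤n) p<k)
    (unreachable-left k S (ℕ.≤∧≢⇒< (ℕ.≤-trans (n≤1+pred[n] (pending S)) p<k) (¬r′ ∘ here)) ¬r′)
  where
  ¬r′ : ¬ Reaches k S
  ¬r′ = ¬r ∘ there (ℕ.<⇒≢ p<k)

-- A dimer k that cannot be inserted touches nothing above it, hence is a second maximal piece.
insertBottom : ∀ a C → pending C ≡ 0 → Admissible (heapOf (a ∷ pieces C)) →
               ∃[ C′ ] pending C′ ≡ 0 × Iso (heapOf (a ∷ pieces C)) (heapOf (pieces C′))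
insertBottom mono C p≡0 _ =
  true ∷ C , cong pred p≡0 , subst (Iso (heapOf (mono ∷ pieces C)) ∘ heapOf) (sym (pieces-true-unmatched C p≡0))
                                    (Iso-refl {heapOf (mono ∷ pieces C)})
insertBottom (dimer k) C p≡0 adm with reaches? k C
... | yes r  = insertArch r , trans (pending-insertArch r) p≡0 , Iso-insertArch r (subst (_≤ k) (sym p≡0) z≤n)
... | no ¬r = ⊥-elim (k≢0 (ℕ.suc-injective (second-top adm)))
  where
  k≢0 : k ≢ 0
  k≢0 refl = ¬r (here p≡0)
  bottom-maximal : IsMaximal (heapOf (dimer k ∷ pieces C)) zero
  bottom-maximal zero    _          = refl
  bottom-maximal (suc _) (i , k~i , _) =
    ⊥-elim (right<left⇒¬concurrent (dimer k) (lookup (pieces C) i)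
              (s≤s (unreachable-left k C (subst (_< k) (sym p≡0) (ℕ.n≢0⇒n>0 k≢0)) ¬r i)) k~i)
  second-top : Admissible (heapOf (dimer k ∷ pieces C)) → suc k ≡ 1
  second-top (inj₂ (m , _ , unique , m-left)) =
    trans (cong (left ∘ lookup (dimer k ∷ pieces C)) (unique zero bottom-maximal)) m-left

normalForm : ∀ w → Admissible (heapOf w) → ∃[ C ] pending C ≡ 0 × Iso (heapOf w) (heapOf (pieces C))
normalForm []      _   = [] , refl , Iso-refl {heapOf []}
normalForm (a ∷ w) adm with normalForm w (Admissible-tail a w adm)
... | C′ , p′≡0 , I′
  with insertBottom a C′ p′≡0 (Admissible-Iso {heapOf (a ∷ w)} {heapOf (a ∷ pieces C′)} (Iso-∷ a I′) adm)
...   | C , p≡0 , I = C , p≡0 , Iso-trans {heapOf (a ∷ w)} {heapOf (a ∷ pieces C′)} {heapOf (pieces C)} (Iso-∷ a I′) I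

classify : ∀ H → Admissible H → ∃[ C ] pending C ≡ 0 × Iso H (heapOf (pieces C))
classify H adm with linearize (fromHeap H)
... | w , I with normalForm w (Admissible-Iso {H} {heapOf w} I adm)
...   | C , p≡0 , J = C , p≡0 , Iso-trans {H} {heapOf w} {heapOf (pieces C)} I J

allWords-length : ∀ n → All (λ w → length w ≡ n) (allWords n)
allWords-length zero    = refl ∷ []
allWords-length (suc n) = extend (allWords n) (allWords-length n)
  where
  extend : ∀ ws → All (λ w → length w ≡ n) ws →
           All (λ w → length w ≡ suc n) (concatMap (λ w → (true ∷ w) ∷ (false ∷ w) ∷ []) ws)
  extend []       []       = []
  extend (w ∷ ws) (l ∷ ls) = cong suc l ∷ cong suc l ∷ extend ws ls

∈-allWords : ∀ w → w ∈ allWords (length w)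
∈-allWords []      = here refl
∈-allWords (b ∷ w) = extend b (allWords (length w)) (∈-allWords w)
  where
  extend : ∀ b ws → w ∈ ws → b ∷ w ∈ concatMap (λ w → (true ∷ w) ∷ (false ∷ w) ∷ []) ws
  extend true  (_ ∷ _)  (here refl) = here refl
  extend false (_ ∷ _)  (here refl) = there (here refl)
  extend b     (_ ∷ ws) (there w∈) = there (there (extend b ws w∈))

allWords-unique : ∀ n → AllPairs _≢_ (allWords n)
allWords-unique zero    = [] ∷ []
allWords-unique (suc n) = extend (allWords n) (allWords-unique n)
  where
  ext = λ (w : List Bool) → (true ∷ w) ∷ (false ∷ w) ∷ []
  apart : ∀ b w ws → All (w ≢_) ws → All (b ∷ w ≢_) (concatMap ext ws)
  apart b w []       []          = []
  apart b w (v ∷ vs) (w≢v ∷ w∉) = w≢v ∘ ∷-injectiveʳ ∷ w≢v ∘ ∷-injectiveʳ ∷ apart b w vs w∉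
  extend : ∀ ws → AllPairs _≢_ ws → AllPairs _≢_ (concatMap ext ws)
  extend []       []           = []
  extend (w ∷ ws) (w∉ ∷ ws!) = ((λ ()) ∷ apart true w ws w∉) ∷ apart false w ws w∉ ∷ extend ws ws!

∈-matchings⁻ : ∀ {n C} → C ∈ matchings n → length C ≡ n × pending C ≡ 0
∈-matchings⁻ {n} {C} C∈ with ∈-filter⁻ (T? ∘ prefixOK 0) C∈
... | C∈all , ok = All.lookup (allWords-length n) C∈all , ℕ.n≤0⇒n≡0 (prefixOK⇒pending≤ 0 C ok)

∈-matchings⁺ : ∀ C → pending C ≡ 0 → C ∈ matchings (length C)
∈-matchings⁺ C p≡0 = ∈-filter⁺ (T? ∘ prefixOK 0) (∈-allWords C) (pending≤⇒prefixOK 0 C (ℕ.≤-reflexive p≡0))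

matchingHeaps : ℕ → List Heap
matchingHeaps n = map (heapOf ∘ pieces) (matchings n)

matchings-valid : ∀ n → All (λ C → length C ≡ n × pending C ≡ 0) (matchings n)
matchings-valid n = All.tabulate ∈-matchings⁻

matchingHeaps-admissible : ∀ n → All (λ H → Admissible H × yExp H ≡ n) (matchingHeaps n)
matchingHeaps-admissible n =
  All.map⁺ (All.map (λ { {C} (len , p≡0) → pieces-admissible C , trans (yExp-matching C p≡0) len }) (matchings-valid n))

matchingHeaps-distinct : ∀ n → AllPairs (λ H H′ → ¬ Iso H H′) (matchingHeaps n)
matchingHeaps-distinct n = AllPairs.map⁺ (AllPairs-map-local
  (λ { {C} {C′} (len , _) (len′ , _) C≢C′ I → C≢C′ (pieces-injective C C′ (trans len (sym len′)) I) })
  (matchings-valid n) (AllPairs.filter⁺ (T? ∘ prefixOK 0) (allWords-unique n)))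

matchingHeaps-complete : ∀ n H → Admissible H → yExp H ≡ n → Any (Iso H) (matchingHeaps n)
matchingHeaps-complete n H adm yExp≡n with classify H adm
... | C , p≡0 , I = Any.map⁺ (Any.map (λ { refl → I }) (subst (λ m → C ∈ matchings m) length≡n (∈-matchings⁺ C p≡0)))
  where
  length≡n : length C ≡ n
  length≡n = trans (sym (yExp-matching C p≡0)) (trans (sym (yExp-Iso {H} {heapOf (pieces C)} I)) yExp≡n)

matchingHeaps-statistics : ∀ n →
  map (λ H → (xExp H , pExp H)) (matchingHeaps n) ≡ map (λ C → (archCount C , weight C)) (matchings n)
matchingHeaps-statistics n = trans (sym (map-∘ (matchings n)))
  (map-cong-local (All.map (λ { {C} (_ , p≡0) → cong₂ _,_ (xExp-matching C p≡0) (pExp-matching C p≡0) })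
                           (matchings-valid n)))

proposition7p4 : ∀ (n : ℕ) → Σ (List Heap) λ L →
    IsClassList n L ×
    (map {B = Exps} (λ H → (xExp H , pExp H)) L ↭ map {B = Exps} (λ C → (archCount C , weight C)) (matchings n))
proposition7p4 n =
  matchingHeaps n ,
  (matchingHeaps-admissible n , matchingHeaps-distinct n , matchingHeaps-complete n) ,
  ↭-reflexive (matchingHeaps-statistics n)
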